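{- For every integer $n>0$, \[ \sum_{k=0}^{\infty}P_2\!\left(n-\frac{k(k+1)}{2}\right)\equiv 0 \pmod 2. \]
   Context: $P_2(n)$ denotes the number of partitions of $n$ into parts not congruent to $2 \pmod 4$, with the convention $P_2(x)=0$ whenever $x$ is not a nonnegative integer. -}

module Defs where

open import Data.Nat using (ℕ; zero; suc; _+_; _*_; _∸_; _≤_; _≤?_; _≟_)
open import Data.Nat.DivMod using (_/_; _%_)
open import Data.List using (List; []; _∷_; [_]; map; concatMap; filter; applyUpTo; length)
open import Data.List.Relation.Unary.All using (All; all?)
open import Relation.Nullary using (¬_)
open import Relation.Nullary.Decidable using (¬?)
open import Relation.Binary.PropositionalEquality using (_≡_)

NotTwoMod4 : ℕ → Set
NotTwoMod4 p = ¬ (p % 4 ≡ 2)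

-- partsBounded fuel m n : all partitions of n (as non-increasing lists of
-- positive parts) whose largest part is ≤ m.  Each partition is listed
-- exactly once.  'fuel' only ensures structural recursion; fuel ≥ n suffices
-- because every part is ≥ 1.
partsBounded : ℕ → ℕ → ℕ → List (List ℕ)
partsBounded _        m zero    = [ [] ]
partsBounded zero     m (suc n) = []
partsBounded (suc f)  m (suc n) =
  concatMap (λ p → map (p ∷_) (partsBounded f p (suc n ∸ p)))
            (filter (λ p → p ≤? suc n) (applyUpTo suc m))

partitions : ℕ → List (List ℕ)
partitions n = partsBounded n n n

P₂ : ℕ → ℕ
P₂ n = length (filter (all? (λ p → ¬? (p % 4 ≟ 2))) (partitions n))

tri : ℕ → ℕ
tri k = (k * suc k) / 2

term : ℕ → ℕ → ℕ
term n k with tri k ≤? n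
... | Relation.Nullary.yes _ = P₂ (n ∸ tri k)
... | Relation.Nullary.no  _ = 0

sumTo : ℕ → (ℕ → ℕ) → ℕ
sumTo zero    f = f 0
sumTo (suc N) f = sumTo N f + f (suc N)

-- Σ_{k≥0} P₂(n - k(k+1)/2); all terms with k > n vanish since k(k+1)/2 ≥ k.
triSum : ℕ → ℕ
triSum n = sumTo n (term n)

-- Over 𝔽₂ the generating function of P₂ is ∏_{m ≢ 2 (mod 4)} (1 + q^m)⁻¹, and
-- the sum in question is the coefficient of q^n in ψ(q) = ∑_k q^{k(k+1)/2} times it.
-- The Jacobi triple product, read modulo 2, gives
--   ψ(q) ≡ ∏_k (1 + q^{4k+1}) (1 + q^{4k+3}) (1 + q^{4k+4}) = ∏_{m ≢ 2 (mod 4)} (1 + q^m),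
-- so the product is 1 and every positive coefficient is even.  Everything is done
-- with finite products and congruences modulo q^K: the finite identity
--   q^N ∏_{i<N} (1 + q^{4i+1}) (1 + q^{4i+3}) = ∑_{j ≤ 2N} q^{j + 2(j-N)²} [2N choose j]_{q⁴}
-- comes from expanding ∏_{i<N} (1 + z q^{4i+2}) (z + q^{4i+2}) in an auxiliary
-- variable z and substituting z = q, and multiplying by (q⁴; q⁴)_{2N} turns each
-- Gaussian binomial with j near N into 1 modulo a high power of q.

module Submission where

open import Algebra.Bundles using (CommutativeMonoid; CommutativeRing)

module RangeFold {c ℓ} (M : CommutativeMonoid c ℓ) where

  open import Data.Nat using (ℕ; zero; suc; _+_; _*_; _∸_; _<_)
  open import Data.Nat.Properties using (+-comm; +-suc; m<n⇒m<1+n; n<1+n)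
  open import Relation.Binary.PropositionalEquality using (_≡_; cong)
  open CommutativeMonoid M
  open import Relation.Binary.Reasoning.Setoid setoid
  open import Algebra.Properties.CommutativeSemigroup commutativeSemigroup using (interchange)

  ⨀ : ℕ → (ℕ → Carrier) → Carrier
  ⨀ zero    f = ε
  ⨀ (suc n) f = ⨀ n f ∙ f n

  ⨀-≡ : ∀ {m n} f → m ≡ n → ⨀ m f ≈ ⨀ n f
  ⨀-≡ f m≡n = reflexive (cong (λ m → ⨀ m f) m≡n)

  ⨀-cong : ∀ n {f g} → (∀ i → i < n → f i ≈ g i) → ⨀ n f ≈ ⨀ n g
  ⨀-cong zero    f≈g = refl
  ⨀-cong (suc n) f≈g = ∙-cong (⨀-cong n (λ i i<n → f≈g i (m<n⇒m<1+n i<n))) (f≈g n (n<1+n n))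

  ⨀-ε : ∀ n → ⨀ n (λ _ → ε) ≈ ε
  ⨀-ε zero    = refl
  ⨀-ε (suc n) = trans (identityʳ _) (⨀-ε n)

  ⨀-∙ : ∀ n f g → ⨀ n (λ i → f i ∙ g i) ≈ ⨀ n f ∙ ⨀ n g
  ⨀-∙ zero    f g = sym (identityˡ ε)
  ⨀-∙ (suc n) f g = trans (∙-cong (⨀-∙ n f g) refl) (interchange (⨀ n f) (⨀ n g) (f n) (g n))

  ⨀-+ : ∀ m n f → ⨀ (m + n) f ≈ ⨀ m f ∙ ⨀ n (λ i → f (m + i))
  ⨀-+ m zero    f = trans (⨀-≡ f (+-comm m 0)) (sym (identityʳ (⨀ m f)))
  ⨀-+ m (suc n) f = begin
    ⨀ (m + suc n) f                              ≈⟨ ⨀-≡ f (+-suc m n) ⟩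
    ⨀ (m + n) f ∙ f (m + n)                      ≈⟨ ∙-cong (⨀-+ m n f) refl ⟩
    (⨀ m f ∙ ⨀ n (λ i → f (m + i))) ∙ f (m + n)  ≈⟨ assoc _ _ _ ⟩
    ⨀ m f ∙ ⨀ (suc n) (λ i → f (m + i))          ∎

  ⨀-reverse : ∀ n f → ⨀ n f ≈ ⨀ n (λ i → f (n ∸ suc i))
  ⨀-reverse zero    f = refl
  ⨀-reverse (suc n) f = begin
    ⨀ n f ∙ f n                                        ≈⟨ ∙-cong (⨀-reverse n f) refl ⟩
    ⨀ n (λ i → f (n ∸ suc i)) ∙ f n                    ≈⟨ comm _ _ ⟩
    f n ∙ ⨀ n (λ i → f (n ∸ suc i))                    ≈⟨ ∙-cong (sym (identityˡ (f n))) refl ⟩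
    ⨀ 1 (λ i → f (n ∸ i)) ∙ ⨀ n (λ i → f (n ∸ suc i))  ≈⟨ sym (⨀-+ 1 n (λ i → f (n ∸ i))) ⟩
    ⨀ (suc n) (λ i → f (n ∸ i))                        ∎

  ⨀-blocks : ∀ k n f → ⨀ (n * k) f ≈ ⨀ n (λ j → ⨀ k (λ r → f (j * k + r)))
  ⨀-blocks k zero    f = refl
  ⨀-blocks k (suc n) f = begin
    ⨀ (k + n * k) f                              ≈⟨ ⨀-≡ f (+-comm k (n * k)) ⟩
    ⨀ (n * k + k) f                              ≈⟨ ⨀-+ (n * k) k f ⟩
    ⨀ (n * k) f ∙ ⨀ k (λ r → f (n * k + r))      ≈⟨ ∙-cong (⨀-blocks k n f) refl ⟩
    ⨀ (suc n) (λ j → ⨀ k (λ r → f (j * k + r)))  ∎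

open import Level using (Level)
open import Function using (_∘_)
open import Data.Bool using (Bool; true; false; _∧_)
open import Data.Product using (_,_)
open import Data.Maybe using (Maybe; just; nothing)
open import Data.Nat using (ℕ; zero; suc; _+_; _*_; _∸_; _≤_; _<_; z≤n; s≤s; _≤?_; _<?_; _≟_; NonZero; ∣_-_∣; parity)
open import Data.Nat.Properties
  using ( ≤-refl; ≤-reflexive; ≤-trans; <-≤-trans; ≤-pred; ≮⇒≥; ≰⇒>; m<n⇒m<1+n; n<1+n; suc-injective
        ; +-comm; +-assoc; +-suc; +-identityʳ; *-comm; *-distribˡ-+; *-cancelˡ-≡
        ; +-cancelˡ-<; +-cancelʳ-≤; +-monoʳ-<; +-mono-≤; +-monoˡ-≤; +-monoʳ-≤; *-monoʳ-≤
        ; m≤m+n; m≤n+m; m≤m*n; m≤n*m; m+[n∸m]≡n; m∸n+n≡m; m∸n≤m; m+n≤o⇒m≤o∸n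
        ; ∣-∣-identityʳ; ∣-∣-comm; ∣m-m+n∣≡n; m≤n+∣n-m∣; m≤n+∣m-n∣; module ≤-Reasoning )
open import Data.Nat.DivMod using (_%_; _/_; [m+n]%n≡m%n; [m+kn]%n≡m%n; m<n⇒m%n≡m; m*n/n≡m)
open import Data.Nat.Divisibility using (_∣_; divides)
open import Data.Nat.Tactic.RingSolver using (solve-∀)
open import Data.Parity.Base as ℙ using (Parity; 0ℙ; 1ℙ)
open import Data.Parity.Properties using (+-*-commutativeRing; +-homo-+)
  renaming ( _≟_ to _≟ₚ_; +-assoc to +ₚ-assoc; +-comm to +ₚ-comm; +-identityʳ to +ₚ-identityʳ; p+p≡0ℙ to p+ₚp≡0ℙ
           ; *-assoc to *ₚ-assoc; *-comm to *ₚ-comm; *-zeroʳ to *ₚ-zeroʳ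
           ; *-distribˡ-+ to *ₚ-distribˡ-+ₚ; *-distribʳ-+ to *ₚ-distribʳ-+ₚ
           ; +-commutativeSemigroup to +ₚ-commutativeSemigroup )
open import Data.List using (List; []; _∷_; [_]; _++_; map; concatMap; filter; applyUpTo; length)
open import Data.List.Properties
  using (length-++; filter-++; concatMap-++; filter-accept; filter-reject; applyUpTo-∷ʳ; ++-identityʳ)
open import Data.List.Relation.Unary.All using (all?)
open import Relation.Nullary using (yes; no; does)
open import Relation.Nullary.Decidable using (¬?)
open import Relation.Unary using (Pred; Decidable)
open import Relation.Binary.Bundles using (Setoid)
open import Relation.Binary.PropositionalEquality using (_≡_; refl; sym; trans; cong; cong₂; subst; module ≡-Reasoning)
import Relation.Binary.Reasoning.Setoid
open import Algebra.Properties.CommutativeSemigroup +ₚ-commutativeSemigroup using () renaming (interchange to +ₚ-interchange)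
open import Algebra.Solver.Ring.AlmostCommutativeRing using (fromCommutativeRing; _-Raw-AlmostCommutative⟶_)
import Algebra.Solver.Ring
open import Defs

-- Formal power series over 𝔽₂

-- Data.Parity gives _+_ and _*_ the same precedence; these aliases restore the usual one.
infixl 6 _+ₚ_
_+ₚ_ : Parity → Parity → Parity
_+ₚ_ = ℙ._+_

infixl 7 _*ₚ_
_*ₚ_ : Parity → Parity → Parity
_*ₚ_ = ℙ._*_

Series : Set
Series = ℕ → Parity

infix 4 _≈_
_≈_ : Series → Series → Set
f ≈ g = ∀ n → f n ≡ g n

infixl 6 _⊕_
_⊕_ : Series → Series → Series
(f ⊕ g) n = f n +ₚ g n

𝟘 : Series
𝟘 _ = 0ℙ

𝟙 : Series
𝟙 zero    = 1ℙ
𝟙 (suc _) = 0ℙ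

tail : Series → Series
tail f n = f (suc n)

infixl 7 _⊗_
_⊗_ : Series → Series → Series
(f ⊗ g) zero    = f 0 *ₚ g 0
(f ⊗ g) (suc n) = (f 0 *ₚ g (suc n)) +ₚ (tail f ⊗ g) n

⊗-congʳ : ∀ g {f f′} → f ≈ f′ → f ⊗ g ≈ f′ ⊗ g
⊗-congʳ g f≈f′ zero    = cong (_*ₚ g 0) (f≈f′ 0)
⊗-congʳ g f≈f′ (suc n) =
  cong₂ _+ₚ_ (cong (_*ₚ g (suc n)) (f≈f′ 0)) (⊗-congʳ g (λ m → f≈f′ (suc m)) n)

⊗-congˡ : ∀ f {g g′} → g ≈ g′ → f ⊗ g ≈ f ⊗ g′
⊗-congˡ f g≈g′ zero    = cong (f 0 *ₚ_) (g≈g′ 0)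
⊗-congˡ f g≈g′ (suc n) = cong₂ _+ₚ_ (cong (f 0 *ₚ_) (g≈g′ (suc n))) (⊗-congˡ (tail f) g≈g′ n)

⊕-congˡ : ∀ f {g g′} → g ≈ g′ → f ⊕ g ≈ f ⊕ g′
⊕-congˡ f g≈g′ n = cong (f n +ₚ_) (g≈g′ n)

⊕-congʳ : ∀ g {f f′} → f ≈ f′ → f ⊕ g ≈ f′ ⊕ g
⊕-congʳ g f≈f′ n = cong (_+ₚ g n) (f≈f′ n)

⊗-zeroˡ : ∀ f → 𝟘 ⊗ f ≈ 𝟘
⊗-zeroˡ f zero    = refl
⊗-zeroˡ f (suc n) = ⊗-zeroˡ f n

⊕-identityʳ : ∀ f → f ⊕ 𝟘 ≈ f
⊕-identityʳ f n = +ₚ-identityʳ (f n)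

⊗-distribʳ-⊕ : ∀ f g h → (f ⊕ g) ⊗ h ≈ f ⊗ h ⊕ g ⊗ h
⊗-distribʳ-⊕ f g h zero    = *ₚ-distribʳ-+ₚ (h 0) (f 0) (g 0)
⊗-distribʳ-⊕ f g h (suc n) =
  trans (cong₂ _+ₚ_ (*ₚ-distribʳ-+ₚ (h (suc n)) (f 0) (g 0)) (⊗-distribʳ-⊕ (tail f) (tail g) h n))
        (+ₚ-interchange (f 0 *ₚ h (suc n)) (g 0 *ₚ h (suc n)) ((tail f ⊗ h) n) ((tail g ⊗ h) n))

⊗-distribˡ-⊕ : ∀ f g h → f ⊗ (g ⊕ h) ≈ f ⊗ g ⊕ f ⊗ h
⊗-distribˡ-⊕ f g h zero    = *ₚ-distribˡ-+ₚ (f 0) (g 0) (h 0)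
⊗-distribˡ-⊕ f g h (suc n) =
  trans (cong₂ _+ₚ_ (*ₚ-distribˡ-+ₚ (f 0) (g (suc n)) (h (suc n))) (⊗-distribˡ-⊕ (tail f) g h n))
        (+ₚ-interchange (f 0 *ₚ g (suc n)) (f 0 *ₚ h (suc n)) ((tail f ⊗ g) n) ((tail f ⊗ h) n))

⊗-sucʳ : ∀ f g n → (f ⊗ g) (suc n) ≡ (f ⊗ tail g) n +ₚ (f (suc n) *ₚ g 0)
⊗-sucʳ f g zero    = refl
⊗-sucʳ f g (suc n) = begin
  (f 0 *ₚ g (suc (suc n))) +ₚ (tail f ⊗ g) (suc n)
    ≡⟨ cong ((f 0 *ₚ g (suc (suc n))) +ₚ_) (⊗-sucʳ (tail f) g n) ⟩
  (f 0 *ₚ g (suc (suc n))) +ₚ ((tail f ⊗ tail g) n +ₚ (f (suc (suc n)) *ₚ g 0))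
    ≡⟨ sym (+ₚ-assoc (f 0 *ₚ g (suc (suc n))) ((tail f ⊗ tail g) n) (f (suc (suc n)) *ₚ g 0)) ⟩
  (f ⊗ tail g) (suc n) +ₚ (f (suc (suc n)) *ₚ g 0)  ∎
  where open ≡-Reasoning

⊗-comm : ∀ f g → f ⊗ g ≈ g ⊗ f
⊗-comm f g zero    = *ₚ-comm (f 0) (g 0)
⊗-comm f g (suc n) = begin
  (f 0 *ₚ g (suc n)) +ₚ (tail f ⊗ g) n  ≡⟨ cong₂ _+ₚ_ (*ₚ-comm (f 0) (g (suc n))) (⊗-comm (tail f) g n) ⟩
  (g (suc n) *ₚ f 0) +ₚ (g ⊗ tail f) n  ≡⟨ +ₚ-comm (g (suc n) *ₚ f 0) ((g ⊗ tail f) n) ⟩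
  (g ⊗ tail f) n +ₚ (g (suc n) *ₚ f 0)  ≡⟨ sym (⊗-sucʳ g f n) ⟩
  (g ⊗ f) (suc n)                       ∎
  where open ≡-Reasoning

scale : Parity → Series → Series
scale p f n = p *ₚ f n

⊗-scaleˡ : ∀ p f g → scale p f ⊗ g ≈ scale p (f ⊗ g)
⊗-scaleˡ p f g zero    = *ₚ-assoc p (f 0) (g 0)
⊗-scaleˡ p f g (suc n) =
  trans (cong₂ _+ₚ_ (*ₚ-assoc p (f 0) (g (suc n))) (⊗-scaleˡ p (tail f) g n))
        (sym (*ₚ-distribˡ-+ₚ p (f 0 *ₚ g (suc n)) ((tail f ⊗ g) n)))

-- The first step also unfolds tail (f ⊗ g) to scale (f 0) (tail g) ⊕ tail f ⊗ g.
⊗-assoc : ∀ f g h → (f ⊗ g) ⊗ h ≈ f ⊗ (g ⊗ h)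
⊗-assoc f g h zero    = *ₚ-assoc (f 0) (g 0) (h 0)
⊗-assoc f g h (suc n) = begin
  ((f 0 *ₚ g 0) *ₚ h (suc n)) +ₚ (tail (f ⊗ g) ⊗ h) n
    ≡⟨ cong (_+ₚ (tail (f ⊗ g) ⊗ h) n) (*ₚ-assoc (f 0) (g 0) (h (suc n))) ⟩
  a +ₚ ((scale (f 0) (tail g) ⊕ tail f ⊗ g) ⊗ h) n
    ≡⟨ cong (a +ₚ_) (⊗-distribʳ-⊕ (scale (f 0) (tail g)) (tail f ⊗ g) h n) ⟩
  a +ₚ ((scale (f 0) (tail g) ⊗ h) n +ₚ ((tail f ⊗ g) ⊗ h) n)
    ≡⟨ cong (a +ₚ_) (cong₂ _+ₚ_ (⊗-scaleˡ (f 0) (tail g) h n) (⊗-assoc (tail f) g h n)) ⟩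
  a +ₚ ((f 0 *ₚ (tail g ⊗ h) n) +ₚ (tail f ⊗ (g ⊗ h)) n)
    ≡⟨ sym (+ₚ-assoc a (f 0 *ₚ (tail g ⊗ h) n) ((tail f ⊗ (g ⊗ h)) n)) ⟩
  (a +ₚ (f 0 *ₚ (tail g ⊗ h) n)) +ₚ (tail f ⊗ (g ⊗ h)) n
    ≡⟨ cong (_+ₚ (tail f ⊗ (g ⊗ h)) n) (sym (*ₚ-distribˡ-+ₚ (f 0) (g 0 *ₚ h (suc n)) ((tail g ⊗ h) n))) ⟩
  (f 0 *ₚ (g ⊗ h) (suc n)) +ₚ (tail f ⊗ (g ⊗ h)) n  ∎
  where
  open ≡-Reasoning
  a = f 0 *ₚ (g 0 *ₚ h (suc n))

⊗-identityˡ : ∀ f → 𝟙 ⊗ f ≈ f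
⊗-identityˡ f zero    = refl
⊗-identityˡ f (suc n) = trans (cong (f (suc n) +ₚ_) (⊗-zeroˡ f n)) (+ₚ-identityʳ (f (suc n)))

⊗-identityʳ : ∀ f → f ⊗ 𝟙 ≈ f
⊗-identityʳ f n = trans (⊗-comm f 𝟙 n) (⊗-identityˡ f n)

⊗-zeroʳ : ∀ f → f ⊗ 𝟘 ≈ 𝟘
⊗-zeroʳ f n = trans (⊗-comm f 𝟘 n) (⊗-zeroˡ f n)

series-commutativeRing : CommutativeRing _ _
series-commutativeRing = record
  { Carrier = Series ; _≈_ = _≈_ ; _+_ = _⊕_ ; _*_ = _⊗_ ; -_ = λ f → f ; 0# = 𝟘 ; 1# = 𝟙
  ; isCommutativeRing = record
    { isRing = record
      { +-isAbelianGroup = record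
        { isGroup = record
          { isMonoid = record
            { isSemigroup = record
              { isMagma = record
                { isEquivalence = record
                  { refl = λ _ → refl ; sym = λ e n → sym (e n) ; trans = λ e e′ n → trans (e n) (e′ n) }
                ; ∙-cong = λ e e′ n → cong₂ _+ₚ_ (e n) (e′ n) }
              ; assoc = λ f g h n → +ₚ-assoc (f n) (g n) (h n) }
            ; identity = (λ f n → refl) , (λ f n → +ₚ-identityʳ (f n)) }
          ; inverse = (λ f n → p+ₚp≡0ℙ (f n)) , (λ f n → p+ₚp≡0ℙ (f n))
          ; ⁻¹-cong = λ e → e }
        ; comm = λ f g n → +ₚ-comm (f n) (g n) }
      ; *-cong = λ {f} {f′} {g} e e′ n → trans (⊗-congʳ g e n) (⊗-congˡ f′ e′ n)
      ; *-assoc = ⊗-assoc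
      ; *-identity = ⊗-identityˡ , ⊗-identityʳ
      ; distrib = ⊗-distribˡ-⊕ , (λ h f g → ⊗-distribʳ-⊕ f g h) }
    ; *-comm = ⊗-comm } }

constant : Parity → Series
constant 1ℙ = 𝟙
constant 0ℙ = 𝟘

constant-homomorphism :
  CommutativeRing.rawRing +-*-commutativeRing -Raw-AlmostCommutative⟶ fromCommutativeRing series-commutativeRing
constant-homomorphism = record
  { ⟦_⟧ = constant ; +-homo = +-homo ; *-homo = *-homo
  ; -‿homo = λ _ _ → refl ; 0-homo = λ _ → refl ; 1-homo = λ _ → refl }
  where
  +-homo : ∀ a b → constant (a +ₚ b) ≈ constant a ⊕ constant b
  +-homo 1ℙ 1ℙ n = sym (p+ₚp≡0ℙ (𝟙 n))
  +-homo 1ℙ 0ℙ n = sym (+ₚ-identityʳ (𝟙 n))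
  +-homo 0ℙ b  n = refl
  *-homo : ∀ a b → constant (a *ₚ b) ≈ constant a ⊗ constant b
  *-homo 1ℙ b n = sym (⊗-identityˡ (constant b) n)
  *-homo 0ℙ b n = sym (⊗-zeroˡ (constant b) n)

constant-≟ : ∀ a b → Maybe (constant a ≈ constant b)
constant-≟ a b with a ≟ₚ b
... | yes refl = just (λ _ → refl)
... | no  _    = nothing

-- Normalising with coefficients in Parity lets the solver use 1 + 1 = 0.
module Solver = Algebra.Solver.Ring (CommutativeRing.rawRing +-*-commutativeRing)
  (fromCommutativeRing series-commutativeRing) constant-homomorphism constant-≟

open CommutativeRing series-commutativeRing public
  using (+-commutativeMonoid; *-commutativeMonoid)
  renaming (setoid to ≈-setoid; refl to ≈-refl; sym to ≈-sym; trans to ≈-trans; +-cong to ⊕-cong; *-cong to ⊗-cong)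

open import Algebra.Properties.CommutativeSemigroup (CommutativeRing.*-commutativeSemigroup series-commutativeRing)
  using () renaming (interchange to ⊗-interchange; x∙yz≈y∙xz to x⊗yz≈y⊗xz)

open Solver using (solve; _:+_; _:*_; _:=_; con)

≡⇒≈ : ∀ {f g} → f ≡ g → f ≈ g
≡⇒≈ refl _ = refl

infix 10 q^_
q^_ : ℕ → Series
(q^ zero)  = 𝟙
(q^ suc c) zero    = 0ℙ
(q^ suc c) (suc n) = (q^ c) n

q^⊗-at : ∀ c f m → (q^ c ⊗ f) (c + m) ≡ f m
q^⊗-at zero    f m = ⊗-identityˡ f m
q^⊗-at (suc c) f m = q^⊗-at c f m

q^⊗-below : ∀ c f {m} → m < c → (q^ c ⊗ f) m ≡ 0ℙ
q^⊗-below (suc c) f {zero}  _         = refl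
q^⊗-below (suc c) f {suc m} (s≤s m<c) = q^⊗-below c f m<c

q^-+ : ∀ c d → q^ (c + d) ≈ q^ c ⊗ q^ d
q^-+ zero    d n       = sym (⊗-identityˡ (q^ d) n)
q^-+ (suc c) d zero    = refl
q^-+ (suc c) d (suc n) = q^-+ c d n

q^⊗q^-≡ : ∀ a b c d → a + b ≡ c + d → q^ a ⊗ q^ b ≈ q^ c ⊗ q^ d
q^⊗q^-≡ a b c d a+b≡c+d = ≈-trans (≈-sym (q^-+ a b)) (≈-trans (≡⇒≈ (cong q^_ a+b≡c+d)) (q^-+ c d))

infix 4 _≈[_]_
_≈[_]_ : Series → ℕ → Series → Set
f ≈[ K ] g = ∀ m → m < K → f m ≡ g m

≈[]-setoid : ℕ → Setoid _ _
≈[]-setoid K = record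
  { Carrier = Series ; _≈_ = _≈[ K ]_
  ; isEquivalence = record
    { refl = λ _ _ → refl ; sym = λ e m m<K → sym (e m m<K) ; trans = λ e e′ m m<K → trans (e m m<K) (e′ m m<K) } }

≈[]-sym : ∀ {K f g} → f ≈[ K ] g → g ≈[ K ] f
≈[]-sym f≈g m m<K = sym (f≈g m m<K)

≈[]-trans : ∀ {K f g h} → f ≈[ K ] g → g ≈[ K ] h → f ≈[ K ] h
≈[]-trans f≈g g≈h m m<K = trans (f≈g m m<K) (g≈h m m<K)

module ≈[]-Reasoning (K : ℕ) = Relation.Binary.Reasoning.Setoid (≈[]-setoid K)

≈⇒≈[] : ∀ {K f g} → f ≈ g → f ≈[ K ] g
≈⇒≈[] f≈g m _ = f≈g m

≈[]-weaken : ∀ {K K′ f g} → K′ ≤ K → f ≈[ K ] g → f ≈[ K′ ] g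
≈[]-weaken K′≤K f≈g m m<K′ = f≈g m (<-≤-trans m<K′ K′≤K)

⊕-cong[] : ∀ {K f f′ g g′} → f ≈[ K ] f′ → g ≈[ K ] g′ → f ⊕ g ≈[ K ] f′ ⊕ g′
⊕-cong[] f≈f′ g≈g′ m m<K = cong₂ _+ₚ_ (f≈f′ m m<K) (g≈g′ m m<K)

⊗-cong[] : ∀ {K f f′ g g′} → f ≈[ K ] f′ → g ≈[ K ] g′ → f ⊗ g ≈[ K ] f′ ⊗ g′
⊗-cong[] f≈f′ g≈g′ zero 0<K = cong₂ _*ₚ_ (f≈f′ 0 0<K) (g≈g′ 0 0<K)
⊗-cong[] {suc K} f≈f′ g≈g′ (suc m) (s≤s m<K) =
  cong₂ _+ₚ_ (cong₂ _*ₚ_ (f≈f′ 0 (s≤s z≤n)) (g≈g′ (suc m) (s≤s m<K)))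
             (⊗-cong[] {K} (λ i i<K → f≈f′ (suc i) (s≤s i<K)) (λ i i<K → g≈g′ i (m<n⇒m<1+n i<K)) m m<K)

q^⊗-≈[]-𝟘 : ∀ {K} c f → K ≤ c → q^ c ⊗ f ≈[ K ] 𝟘
q^⊗-≈[]-𝟘 c f K≤c m m<K = q^⊗-below c f (<-≤-trans m<K K≤c)

q^-≈[]-𝟘 : ∀ {K} c → K ≤ c → q^ c ≈[ K ] 𝟘
q^-≈[]-𝟘 c K≤c m m<K = trans (sym (⊗-identityʳ (q^ c) m)) (q^⊗-≈[]-𝟘 c 𝟙 K≤c m m<K)

q^⊗-cong[] : ∀ {K f g} c → f ≈[ K ] g → q^ c ⊗ f ≈[ c + K ] q^ c ⊗ g
q^⊗-cong[] {K} {f} {g} c f≈g m m<c+K with m <? c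
... | yes m<c = trans (q^⊗-below c f m<c) (sym (q^⊗-below c g m<c))
... | no  m≮c = begin
  (q^ c ⊗ f) m        ≡⟨ cong (q^ c ⊗ f) (sym c+d≡m) ⟩
  (q^ c ⊗ f) (c + d)  ≡⟨ q^⊗-at c f d ⟩
  f d                 ≡⟨ f≈g d (+-cancelˡ-< c d K (subst (_< c + K) (sym c+d≡m) m<c+K)) ⟩
  g d                 ≡⟨ sym (q^⊗-at c g d) ⟩
  (q^ c ⊗ g) (c + d)  ≡⟨ cong (q^ c ⊗ g) c+d≡m ⟩
  (q^ c ⊗ g) m        ∎
  where
  open ≡-Reasoning
  d = m ∸ c
  c+d≡m = m+[n∸m]≡n (≮⇒≥ m≮c)

q^⊗-cancel[] : ∀ {K f g} c → q^ c ⊗ f ≈[ c + K ] q^ c ⊗ g → f ≈[ K ] g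
q^⊗-cancel[] {K} {f} {g} c e m m<K = begin
  f m                 ≡⟨ sym (q^⊗-at c f m) ⟩
  (q^ c ⊗ f) (c + m)  ≡⟨ e (c + m) (+-monoʳ-< c m<K) ⟩
  (q^ c ⊗ g) (c + m)  ≡⟨ q^⊗-at c g m ⟩
  g m                 ∎
  where open ≡-Reasoning

infix 10 1+q^_
1+q^_ : ℕ → Series
1+q^ c = 𝟙 ⊕ q^ c

1+q^-≈[]-𝟙 : ∀ {K} c → K ≤ c → 1+q^ c ≈[ K ] 𝟙
1+q^-≈[]-𝟙 c K≤c m m<K =
  trans (cong (𝟙 m +ₚ_) (trans (sym (⊗-identityʳ (q^ c) m)) (q^⊗-below c 𝟙 (<-≤-trans m<K K≤c)))) (+ₚ-identityʳ (𝟙 m))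

module ≈-Reasoning = Relation.Binary.Reasoning.Setoid ≈-setoid

open RangeFold +-commutativeMonoid public
  using () renaming ( ⨀ to ∑; ⨀-≡ to ∑-≡; ⨀-cong to ∑-cong; ⨀-∙ to ∑-⊕; ⨀-+ to ∑-+
                     ; ⨀-reverse to ∑-reverse; ⨀-blocks to ∑-blocks )
open RangeFold *-commutativeMonoid public
  using () renaming ( ⨀ to ∏; ⨀-≡ to ∏-≡; ⨀-cong to ∏-cong; ⨀-ε to ∏-𝟙; ⨀-∙ to ∏-⊗; ⨀-+ to ∏-+
                     ; ⨀-blocks to ∏-blocks )

⊗-∑ : ∀ n f g → f ⊗ ∑ n g ≈ ∑ n (λ i → f ⊗ g i)
⊗-∑ zero    f g = ⊗-zeroʳ f
⊗-∑ (suc n) f g = ≈-trans (⊗-distribˡ-⊕ f (∑ n g) (g n)) (⊕-cong (⊗-∑ n f g) ≈-refl)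

∑-cong[] : ∀ {K} n f g → (∀ i → i < n → f i ≈[ K ] g i) → ∑ n f ≈[ K ] ∑ n g
∑-cong[] zero    f g f≈g = λ _ _ → refl
∑-cong[] (suc n) f g f≈g = ⊕-cong[] (∑-cong[] n f g (λ i i<n → f≈g i (m<n⇒m<1+n i<n))) (f≈g n (n<1+n n))

∑-≈[]-𝟘 : ∀ {K} n f → (∀ i → i < n → f i ≈[ K ] 𝟘) → ∑ n f ≈[ K ] 𝟘
∑-≈[]-𝟘 zero    f f≈𝟘 = λ _ _ → refl
∑-≈[]-𝟘 (suc n) f f≈𝟘 = ⊕-cong[] (∑-≈[]-𝟘 n f (λ i i<n → f≈𝟘 i (m<n⇒m<1+n i<n))) (f≈𝟘 n (n<1+n n))

∑-even-odd : ∀ N f → ∑ (suc (N + N)) f ≈ ∑ (suc N) (λ k → f (k * 2)) ⊕ ∑ N (λ t → f (t * 2 + 1))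
∑-even-odd N f = begin
  ∑ (N + N) f ⊕ f (N + N)
    ≈⟨ ⊕-cong (∑-≡ f N+N≡N*2) (≡⇒≈ (cong f N+N≡N*2)) ⟩
  ∑ (N * 2) f ⊕ f (N * 2)
    ≈⟨ ⊕-congʳ (f (N * 2)) (∑-blocks 2 N f) ⟩
  ∑ N (λ j → 𝟘 ⊕ f (j * 2 + 0) ⊕ f (j * 2 + 1)) ⊕ f (N * 2)
    ≈⟨ ⊕-congʳ (f (N * 2)) (∑-cong N (λ j _ → ⊕-congʳ (f (j * 2 + 1)) (≡⇒≈ (cong f (+-identityʳ (j * 2)))))) ⟩
  ∑ N (λ j → f (j * 2) ⊕ f (j * 2 + 1)) ⊕ f (N * 2)
    ≈⟨ ⊕-congʳ (f (N * 2)) (∑-⊕ N (λ k → f (k * 2)) (λ t → f (t * 2 + 1))) ⟩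
  E ⊕ O ⊕ f (N * 2)
    ≈⟨ swap E O (f (N * 2)) ⟩
  E ⊕ f (N * 2) ⊕ O  ∎
  where
  open ≈-Reasoning
  E = ∑ N (λ k → f (k * 2))
  O = ∑ N (λ t → f (t * 2 + 1))
  N+N≡N*2 : N + N ≡ N * 2
  N+N≡N*2 = trans (cong (N +_) (sym (+-identityʳ N))) (*-comm 2 N)
  swap : ∀ a b c → a ⊕ b ⊕ c ≈ a ⊕ c ⊕ b
  swap = solve 3 (λ a b c → a :+ b :+ c := a :+ c :+ b) (λ _ → refl)

∏-≈[]-𝟙 : ∀ {K} n f → (∀ i → i < n → f i ≈[ K ] 𝟙) → ∏ n f ≈[ K ] 𝟙
∏-≈[]-𝟙 zero    f f≈𝟙 = λ _ _ → refl
∏-≈[]-𝟙 (suc n) f f≈𝟙 m m<K =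
  trans (⊗-cong[] (∏-≈[]-𝟙 n f (λ i i<n → f≈𝟙 i (m<n⇒m<1+n i<n))) (f≈𝟙 n (n<1+n n)) m m<K) (⊗-identityˡ 𝟙 m)

∏-extend[] : ∀ {K} a d f → (∀ i → i < d → f (a + i) ≈[ K ] 𝟙) → ∏ (a + d) f ≈[ K ] ∏ a f
∏-extend[] a d f f≈𝟙 =
  ≈[]-trans (≈⇒≈[] (∏-+ a d f))
    (≈[]-trans (⊗-cong[] {f = ∏ a f} (λ _ _ → refl) (∏-≈[]-𝟙 d _ f≈𝟙)) (≈⇒≈[] (⊗-identityʳ (∏ a f))))

∏-inverse : ∀ n f g → (∀ i → f i ⊗ g i ≈ 𝟙) → ∏ n f ⊗ ∏ n g ≈ 𝟙
∏-inverse n f g f⊗g≈𝟙 = begin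
  ∏ n f ⊗ ∏ n g          ≈⟨ ≈-sym (∏-⊗ n f g) ⟩
  ∏ n (λ i → f i ⊗ g i)  ≈⟨ ∏-cong n (λ i _ → f⊗g≈𝟙 i) ⟩
  ∏ n (λ _ → 𝟙)          ≈⟨ ∏-𝟙 n ⟩
  𝟙                      ∎
  where open ≈-Reasoning

⊗-cancelʳ : ∀ {f g h h′} → f ⊗ h ≈ g ⊗ h → h ⊗ h′ ≈ 𝟙 → f ≈ g
⊗-cancelʳ {f} {g} {h} {h′} f⊗h≈g⊗h h⊗h′≈𝟙 = begin
  f             ≈⟨ ≈-sym (⊗-identityʳ f) ⟩
  f ⊗ 𝟙         ≈⟨ ⊗-cong ≈-refl (≈-sym h⊗h′≈𝟙) ⟩
  f ⊗ (h ⊗ h′)  ≈⟨ ≈-sym (⊗-assoc f h h′) ⟩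
  (f ⊗ h) ⊗ h′  ≈⟨ ⊗-cong f⊗h≈g⊗h ≈-refl ⟩
  (g ⊗ h) ⊗ h′  ≈⟨ ⊗-assoc g h h′ ⟩
  g ⊗ (h ⊗ h′)  ≈⟨ ⊗-cong ≈-refl h⊗h′≈𝟙 ⟩
  g ⊗ 𝟙         ≈⟨ ⊗-identityʳ g ⟩
  g             ∎
  where open ≈-Reasoning

𝟙⊕-⊗ : ∀ h g n → ((𝟙 ⊕ h) ⊗ g) n ≡ g n +ₚ (h ⊗ g) n
𝟙⊕-⊗ h g n = trans (⊗-distribʳ-⊕ 𝟙 h g n) (cong (_+ₚ (h ⊗ g) n) (⊗-identityˡ g n))

⊗-inverse-recursion : ∀ {f g h} → (𝟙 ⊕ h) ⊗ g ≈ f → ∀ k → g k ≡ f k +ₚ (h ⊗ g) k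
⊗-inverse-recursion {f} {g} {h} [1+h]g≈f k = begin
  g k
    ≡⟨ sym (+ₚ-identityʳ (g k)) ⟩
  g k +ₚ 0ℙ
    ≡⟨ cong (g k +ₚ_) (sym (p+ₚp≡0ℙ ((h ⊗ g) k))) ⟩
  g k +ₚ ((h ⊗ g) k +ₚ (h ⊗ g) k)
    ≡⟨ sym (+ₚ-assoc (g k) ((h ⊗ g) k) ((h ⊗ g) k)) ⟩
  (g k +ₚ (h ⊗ g) k) +ₚ (h ⊗ g) k
    ≡⟨ cong (_+ₚ (h ⊗ g) k) (trans (sym (𝟙⊕-⊗ h g k)) ([1+h]g≈f k)) ⟩
  f k +ₚ (h ⊗ g) k  ∎
  where open ≡-Reasoning

geometric : (d : ℕ) → .{{NonZero d}} → Series
geometric d n = 𝟙 (n % d)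

1+q^⊗geometric : ∀ d .{{_ : NonZero d}} → 1+q^ d ⊗ geometric d ≈ 𝟙
1+q^⊗geometric d@(suc _) n with d ≤? n
... | yes d≤n = begin
  (1+q^ d ⊗ geometric d) n
    ≡⟨ 𝟙⊕-⊗ (q^ d) (geometric d) n ⟩
  geometric d n +ₚ (q^ d ⊗ geometric d) n
    ≡⟨ cong (λ k → geometric d k +ₚ (q^ d ⊗ geometric d) k) (sym d+m≡n) ⟩
  geometric d (d + m) +ₚ (q^ d ⊗ geometric d) (d + m)
    ≡⟨ cong₂ _+ₚ_ (cong 𝟙 (trans (cong (_% d) (+-comm d m)) ([m+n]%n≡m%n m d))) (q^⊗-at d (geometric d) m) ⟩
  geometric d m +ₚ geometric d m
    ≡⟨ p+ₚp≡0ℙ (geometric d m) ⟩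
  0ℙ
    ≡⟨ cong 𝟙 d+m≡n ⟩
  𝟙 n  ∎
  where
  open ≡-Reasoning
  m = n ∸ d
  d+m≡n = m+[n∸m]≡n d≤n
... | no d≰n = trans (𝟙⊕-⊗ (q^ d) (geometric d) n)
  (trans (cong (geometric d n +ₚ_) (q^⊗-below d (geometric d) (≰⇒> d≰n)))
  (trans (+ₚ-identityʳ (geometric d n)) (cong 𝟙 (m<n⇒m%n≡m (≰⇒> d≰n)))))

geometric-≈[]-𝟙 : ∀ d → geometric (suc d) ≈[ suc d ] 𝟙
geometric-≈[]-𝟙 d m m<d+1 = cong 𝟙 (m<n⇒m%n≡m m<d+1)

∏₄ : ℕ → ℕ → Series
∏₄ r k = ∏ k (λ i → 1+q^ (r + 4 * i))

∏₄-extend[] : ∀ {K} r a d → K ≤ r + 4 * a → ∏₄ r (a + d) ≈[ K ] ∏₄ r a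
∏₄-extend[] r a d K≤ = ∏-extend[] a d _ (λ i _ → 1+q^-≈[]-𝟙 _ (≤-trans K≤ (+-monoʳ-≤ r (*-monoʳ-≤ 4 (m≤m+n a i)))))

-- Gaussian binomial coefficients in base q⁴

-- Over 𝔽₂ we have 1 + q^c = 1 − q^c, so this is the q-Pochhammer symbol (q⁴; q⁴)ₖ.
pochhammer₄ : ℕ → Series
pochhammer₄ = ∏₄ 4

pochhammer₄⁻¹ : ℕ → Series
pochhammer₄⁻¹ k = ∏ k (λ i → geometric (4 + 4 * i))

pochhammer₄-inverse : ∀ k → pochhammer₄ k ⊗ pochhammer₄⁻¹ k ≈ 𝟙
pochhammer₄-inverse k = ∏-inverse k _ _ (λ i → 1+q^⊗geometric (4 + 4 * i))

pochhammer₄-from : ℕ → ℕ → Series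
pochhammer₄-from m k = ∏ k (λ i → 1+q^ (4 + 4 * (m + i)))

pochhammer₄-+ : ∀ m k → pochhammer₄ (m + k) ≈ pochhammer₄ m ⊗ pochhammer₄-from m k
pochhammer₄-+ m k = ∏-+ m k _

pochhammer₄-from-≈[]-𝟙 : ∀ m k → pochhammer₄-from m k ≈[ 4 + 4 * m ] 𝟙
pochhammer₄-from-≈[]-𝟙 m k = ∏-≈[]-𝟙 k _ (λ i _ → 1+q^-≈[]-𝟙 _ (+-monoʳ-≤ 4 (*-monoʳ-≤ 4 (m≤m+n m i))))

pochhammer₄-suc-suc : ∀ j m →
  pochhammer₄ (suc j + suc m) ≈ pochhammer₄ (j + suc m) ⊗ (𝟙 ⊕ q^ (4 + 4 * j) ⊗ q^ (4 + 4 * m))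
pochhammer₄-suc-suc j m =
  ⊗-congˡ (pochhammer₄ (j + suc m)) (⊕-congˡ 𝟙 (≈-trans (≡⇒≈ (cong q^_ (exponent j m))) (q^-+ (4 + 4 * j) (4 + 4 * m))))
  where
  exponent : ∀ j m → 4 + 4 * (j + suc m) ≡ (4 + 4 * j) + (4 + 4 * m)
  exponent = solve-∀

-- The Gaussian binomial coefficient [j + m choose j] in base q⁴, defined by one of
-- the two q-Pascal rules.
gauss₄ : ℕ → ℕ → Series
gauss₄ zero    m       = 𝟙
gauss₄ (suc j) zero    = 𝟙
gauss₄ (suc j) (suc m) = q^ (4 + 4 * j) ⊗ gauss₄ (suc j) m ⊕ gauss₄ j (suc m)

gauss₄-zeroʳ : ∀ j → gauss₄ j 0 ≈ 𝟙
gauss₄-zeroʳ zero    = ≈-refl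
gauss₄-zeroʳ (suc j) = ≈-refl

gauss₄-pochhammer₄ : ∀ j m → gauss₄ j m ⊗ (pochhammer₄ j ⊗ pochhammer₄ m) ≈ pochhammer₄ (j + m)
gauss₄-pochhammer₄ zero    m       = ≈-trans (⊗-identityˡ _) (⊗-identityˡ _)
gauss₄-pochhammer₄ (suc j) zero    =
  ≈-trans (⊗-identityˡ _) (≈-trans (⊗-identityʳ _) (∏-≡ _ (sym (+-comm (suc j) 0))))
gauss₄-pochhammer₄ (suc j) (suc m) = begin
  (a ⊗ G₁ ⊕ G₂) ⊗ ((Pj ⊗ (𝟙 ⊕ a)) ⊗ (Pm ⊗ (𝟙 ⊕ b)))
    ≈⟨ expand a b G₁ G₂ Pj Pm ⟩
  (a ⊗ (𝟙 ⊕ b)) ⊗ (G₁ ⊗ ((Pj ⊗ (𝟙 ⊕ a)) ⊗ Pm)) ⊕ (𝟙 ⊕ a) ⊗ (G₂ ⊗ (Pj ⊗ (Pm ⊗ (𝟙 ⊕ b))))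
    ≈⟨ ⊕-cong (⊗-congˡ (a ⊗ (𝟙 ⊕ b)) (≈-trans (gauss₄-pochhammer₄ (suc j) m) (∏-≡ _ (sym (+-suc j m)))))
              (⊗-congˡ (𝟙 ⊕ a) (gauss₄-pochhammer₄ j (suc m))) ⟩
  (a ⊗ (𝟙 ⊕ b)) ⊗ P ⊕ (𝟙 ⊕ a) ⊗ P
    ≈⟨ collect a b P ⟩
  P ⊗ (𝟙 ⊕ a ⊗ b)
    ≈⟨ ≈-sym (pochhammer₄-suc-suc j m) ⟩
  pochhammer₄ (suc j + suc m)  ∎
  where
  open ≈-Reasoning
  a = q^ (4 + 4 * j)
  b = q^ (4 + 4 * m)
  G₁ = gauss₄ (suc j) m
  G₂ = gauss₄ j (suc m)
  Pj = pochhammer₄ j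
  Pm = pochhammer₄ m
  P = pochhammer₄ (j + suc m)
  expand : ∀ a b G₁ G₂ Pj Pm →
    (a ⊗ G₁ ⊕ G₂) ⊗ ((Pj ⊗ (𝟙 ⊕ a)) ⊗ (Pm ⊗ (𝟙 ⊕ b))) ≈
    (a ⊗ (𝟙 ⊕ b)) ⊗ (G₁ ⊗ ((Pj ⊗ (𝟙 ⊕ a)) ⊗ Pm)) ⊕ (𝟙 ⊕ a) ⊗ (G₂ ⊗ (Pj ⊗ (Pm ⊗ (𝟙 ⊕ b))))
  expand = solve 6 (λ a b G₁ G₂ Pj Pm →
    (a :* G₁ :+ G₂) :* ((Pj :* (con 1ℙ :+ a)) :* (Pm :* (con 1ℙ :+ b))) :=
    (a :* (con 1ℙ :+ b)) :* (G₁ :* ((Pj :* (con 1ℙ :+ a)) :* Pm))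
      :+ (con 1ℙ :+ a) :* (G₂ :* (Pj :* (Pm :* (con 1ℙ :+ b)))))
    (λ _ → refl)
  collect : ∀ a b P → (a ⊗ (𝟙 ⊕ b)) ⊗ P ⊕ (𝟙 ⊕ a) ⊗ P ≈ P ⊗ (𝟙 ⊕ a ⊗ b)
  collect = solve 3 (λ a b P → (a :* (con 1ℙ :+ b)) :* P :+ (con 1ℙ :+ a) :* P := P :* (con 1ℙ :+ a :* b)) (λ _ → refl)

gauss₄-pochhammer₄′ : ∀ j m → gauss₄ (suc j) m ⊗ (pochhammer₄ (suc j) ⊗ pochhammer₄ m) ≈ pochhammer₄ (j + suc m)
gauss₄-pochhammer₄′ j m = ≈-trans (gauss₄-pochhammer₄ (suc j) m) (∏-≡ _ (sym (+-suc j m)))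

-- The other q-Pascal rule.  The product formula identifies both sides after
-- multiplying by the invertible series (q⁴; q⁴)_{j+1} (q⁴; q⁴)_{m+1}.
gauss₄-pascal : ∀ j m → gauss₄ (suc j) (suc m) ≈ gauss₄ (suc j) m ⊕ q^ (4 + 4 * m) ⊗ gauss₄ j (suc m)
gauss₄-pascal j m = ⊗-cancelʳ {h′ = pochhammer₄⁻¹ (suc j) ⊗ pochhammer₄⁻¹ (suc m)} multiplied invertible
  where
  open ≈-Reasoning
  a = q^ (4 + 4 * j)
  b = q^ (4 + 4 * m)
  G₁ = gauss₄ (suc j) m
  G₂ = gauss₄ j (suc m)
  Pj = pochhammer₄ j
  Pm = pochhammer₄ m
  P = pochhammer₄ (j + suc m)
  regroup : ∀ a b G₁ G₂ Pj Pm →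
    (𝟙 ⊕ b) ⊗ (G₁ ⊗ ((Pj ⊗ (𝟙 ⊕ a)) ⊗ Pm)) ⊕ (b ⊗ (𝟙 ⊕ a)) ⊗ (G₂ ⊗ (Pj ⊗ (Pm ⊗ (𝟙 ⊕ b)))) ≈
    (G₁ ⊕ b ⊗ G₂) ⊗ ((Pj ⊗ (𝟙 ⊕ a)) ⊗ (Pm ⊗ (𝟙 ⊕ b)))
  regroup = solve 6 (λ a b G₁ G₂ Pj Pm →
    (con 1ℙ :+ b) :* (G₁ :* ((Pj :* (con 1ℙ :+ a)) :* Pm))
      :+ (b :* (con 1ℙ :+ a)) :* (G₂ :* (Pj :* (Pm :* (con 1ℙ :+ b)))) :=
    (G₁ :+ b :* G₂) :* ((Pj :* (con 1ℙ :+ a)) :* (Pm :* (con 1ℙ :+ b))))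
    (λ _ → refl)
  split : ∀ a b P → P ⊗ (𝟙 ⊕ a ⊗ b) ≈ (𝟙 ⊕ b) ⊗ P ⊕ (b ⊗ (𝟙 ⊕ a)) ⊗ P
  split = solve 3 (λ a b P → P :* (con 1ℙ :+ a :* b) := (con 1ℙ :+ b) :* P :+ (b :* (con 1ℙ :+ a)) :* P) (λ _ → refl)
  multiplied : gauss₄ (suc j) (suc m) ⊗ (pochhammer₄ (suc j) ⊗ pochhammer₄ (suc m)) ≈
               (G₁ ⊕ b ⊗ G₂) ⊗ (pochhammer₄ (suc j) ⊗ pochhammer₄ (suc m))
  multiplied = begin
    gauss₄ (suc j) (suc m) ⊗ (pochhammer₄ (suc j) ⊗ pochhammer₄ (suc m))
      ≈⟨ gauss₄-pochhammer₄ (suc j) (suc m) ⟩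
    pochhammer₄ (suc j + suc m)
      ≈⟨ pochhammer₄-suc-suc j m ⟩
    P ⊗ (𝟙 ⊕ a ⊗ b)
      ≈⟨ split a b P ⟩
    (𝟙 ⊕ b) ⊗ P ⊕ (b ⊗ (𝟙 ⊕ a)) ⊗ P
      ≈⟨ ≈-sym (⊕-cong (⊗-congˡ (𝟙 ⊕ b) (gauss₄-pochhammer₄′ j m)) (⊗-congˡ (b ⊗ (𝟙 ⊕ a)) (gauss₄-pochhammer₄ j (suc m)))) ⟩
    (𝟙 ⊕ b) ⊗ (G₁ ⊗ ((Pj ⊗ (𝟙 ⊕ a)) ⊗ Pm)) ⊕ (b ⊗ (𝟙 ⊕ a)) ⊗ (G₂ ⊗ (Pj ⊗ (Pm ⊗ (𝟙 ⊕ b))))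
      ≈⟨ regroup a b G₁ G₂ Pj Pm ⟩
    (G₁ ⊕ b ⊗ G₂) ⊗ (pochhammer₄ (suc j) ⊗ pochhammer₄ (suc m))  ∎
  invertible : (pochhammer₄ (suc j) ⊗ pochhammer₄ (suc m)) ⊗ (pochhammer₄⁻¹ (suc j) ⊗ pochhammer₄⁻¹ (suc m)) ≈ 𝟙
  invertible = ≈-trans (⊗-interchange _ _ _ _)
                       (≈-trans (⊗-cong (pochhammer₄-inverse (suc j)) (pochhammer₄-inverse (suc m))) (⊗-identityˡ 𝟙))

gauss₄-pochhammer₄-from : ∀ j m → gauss₄ j m ⊗ pochhammer₄ j ≈ pochhammer₄-from m j
gauss₄-pochhammer₄-from j m = ⊗-cancelʳ multiplied (pochhammer₄-inverse m)
  where
  open ≈-Reasoning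
  multiplied : (gauss₄ j m ⊗ pochhammer₄ j) ⊗ pochhammer₄ m ≈ pochhammer₄-from m j ⊗ pochhammer₄ m
  multiplied = begin
    (gauss₄ j m ⊗ pochhammer₄ j) ⊗ pochhammer₄ m  ≈⟨ ⊗-assoc _ _ _ ⟩
    gauss₄ j m ⊗ (pochhammer₄ j ⊗ pochhammer₄ m)  ≈⟨ gauss₄-pochhammer₄ j m ⟩
    pochhammer₄ (j + m)                           ≈⟨ ∏-≡ _ (+-comm j m) ⟩
    pochhammer₄ (m + j)                           ≈⟨ pochhammer₄-+ m j ⟩
    pochhammer₄ m ⊗ pochhammer₄-from m j          ≈⟨ ⊗-comm _ _ ⟩
    pochhammer₄-from m j ⊗ pochhammer₄ m          ∎

gauss₄⊗pochhammer₄-≈[]-𝟙 : ∀ {K} j m L → j ≤ L → K ≤ 4 + 4 * m → K ≤ 4 + 4 * j →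
  gauss₄ j m ⊗ pochhammer₄ L ≈[ K ] 𝟙
gauss₄⊗pochhammer₄-≈[]-𝟙 {K} j m L j≤L K≤4m K≤4j = begin
  gauss₄ j m ⊗ pochhammer₄ L
    ≈⟨ ≈⇒≈[] (⊗-congˡ (gauss₄ j m) (∏-≡ _ (sym (m+[n∸m]≡n j≤L)))) ⟩
  gauss₄ j m ⊗ pochhammer₄ (j + (L ∸ j))
    ≈⟨ ≈⇒≈[] (⊗-congˡ (gauss₄ j m) (pochhammer₄-+ j (L ∸ j))) ⟩
  gauss₄ j m ⊗ (pochhammer₄ j ⊗ pochhammer₄-from j (L ∸ j))
    ≈⟨ ≈⇒≈[] (≈-sym (⊗-assoc _ _ _)) ⟩
  (gauss₄ j m ⊗ pochhammer₄ j) ⊗ pochhammer₄-from j (L ∸ j)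
    ≈⟨ ≈⇒≈[] (⊗-congʳ _ (gauss₄-pochhammer₄-from j m)) ⟩
  pochhammer₄-from m j ⊗ pochhammer₄-from j (L ∸ j)
    ≈⟨ ⊗-cong[] (≈[]-weaken K≤4m (pochhammer₄-from-≈[]-𝟙 m j)) (≈[]-weaken K≤4j (pochhammer₄-from-≈[]-𝟙 j (L ∸ j))) ⟩
  𝟙 ⊗ 𝟙
    ≈⟨ ≈⇒≈[] (⊗-identityˡ 𝟙) ⟩
  𝟙  ∎
  where open ≈[]-Reasoning K

-- The Jacobi triple product

-- Polynomials in an auxiliary variable z, by their coefficients of z^j.
ZPoly : Set
ZPoly = ℕ → Series

1ᶻ : ZPoly
1ᶻ zero    = 𝟙
1ᶻ (suc _) = 𝟘

infixl 6 _⊕ᶻ_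
_⊕ᶻ_ : ZPoly → ZPoly → ZPoly
(F ⊕ᶻ G) j = F j ⊕ G j

infixr 7 _·ᶻ_ z·_
_·ᶻ_ : Series → ZPoly → ZPoly
(c ·ᶻ F) j = c ⊗ F j

z·_ : ZPoly → ZPoly
(z· F) zero    = 𝟘
(z· F) (suc j) = F j

evalAtQ : ℕ → ZPoly → Series
evalAtQ K F = ∑ K (λ j → q^ j ⊗ F j)

evalAtQ-⊕ᶻ : ∀ K F G → evalAtQ K (F ⊕ᶻ G) ≈ evalAtQ K F ⊕ evalAtQ K G
evalAtQ-⊕ᶻ K F G = ≈-trans (∑-cong K (λ j _ → ⊗-distribˡ-⊕ (q^ j) (F j) (G j))) (∑-⊕ K _ _)

evalAtQ-·ᶻ : ∀ K c F → evalAtQ K (c ·ᶻ F) ≈ c ⊗ evalAtQ K F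
evalAtQ-·ᶻ K c F = ≈-trans (∑-cong K (λ j _ → x⊗yz≈y⊗xz (q^ j) c (F j))) (≈-sym (⊗-∑ K c (λ j → q^ j ⊗ F j)))

evalAtQ-z· : ∀ K F → evalAtQ (suc K) (z· F) ≈ q^ 1 ⊗ evalAtQ K F
evalAtQ-z· zero    F = ≈-trans (⊕-congˡ 𝟘 (⊗-zeroʳ 𝟙)) (≈-sym (⊗-zeroʳ (q^ 1)))
evalAtQ-z· (suc K) F = begin
  evalAtQ (suc K) (z· F) ⊕ q^ (suc K) ⊗ F K  ≈⟨ ⊕-cong (evalAtQ-z· K F) (⊗-congʳ (F K) (q^-+ 1 K)) ⟩
  q^ 1 ⊗ evalAtQ K F ⊕ (q^ 1 ⊗ q^ K) ⊗ F K   ≈⟨ ⊕-congˡ (q^ 1 ⊗ evalAtQ K F) (⊗-assoc (q^ 1) (q^ K) (F K)) ⟩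
  q^ 1 ⊗ evalAtQ K F ⊕ q^ 1 ⊗ (q^ K ⊗ F K)   ≈⟨ ≈-sym (⊗-distribˡ-⊕ (q^ 1) (evalAtQ K F) (q^ K ⊗ F K)) ⟩
  q^ 1 ⊗ evalAtQ (suc K) F                   ∎
  where open ≈-Reasoning

evalAtQ-top : ∀ K F → F K ≈ 𝟘 → evalAtQ (suc K) F ≈ evalAtQ K F
evalAtQ-top K F FK≈𝟘 =
  ≈-trans (⊕-congˡ (evalAtQ K F) (≈-trans (⊗-congˡ (q^ K) FK≈𝟘) (⊗-zeroʳ (q^ K)))) (⊕-identityʳ (evalAtQ K F))

evalAtQ-step₊ : ∀ K c F → F (suc K) ≈ 𝟘 → evalAtQ (suc (suc K)) (F ⊕ᶻ c ·ᶻ z· F) ≈ (𝟙 ⊕ c ⊗ q^ 1) ⊗ evalAtQ (suc K) F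
evalAtQ-step₊ K c F top≈𝟘 = begin
  evalAtQ (suc (suc K)) (F ⊕ᶻ c ·ᶻ z· F)
    ≈⟨ evalAtQ-⊕ᶻ (suc (suc K)) F (c ·ᶻ z· F) ⟩
  evalAtQ (suc (suc K)) F ⊕ evalAtQ (suc (suc K)) (c ·ᶻ z· F)
    ≈⟨ ⊕-cong (evalAtQ-top (suc K) F top≈𝟘) (evalAtQ-·ᶻ (suc (suc K)) c (z· F)) ⟩
  S ⊕ c ⊗ evalAtQ (suc (suc K)) (z· F)
    ≈⟨ ⊕-congˡ S (⊗-congˡ c (evalAtQ-z· (suc K) F)) ⟩
  S ⊕ c ⊗ (q^ 1 ⊗ S)
    ≈⟨ collect S c (q^ 1) ⟩
  (𝟙 ⊕ c ⊗ q^ 1) ⊗ S  ∎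
  where
  open ≈-Reasoning
  S = evalAtQ (suc K) F
  collect : ∀ S c q → S ⊕ c ⊗ (q ⊗ S) ≈ (𝟙 ⊕ c ⊗ q) ⊗ S
  collect = solve 3 (λ S c q → S :+ c :* (q :* S) := (con 1ℙ :+ c :* q) :* S) (λ _ → refl)

evalAtQ-step₋ : ∀ K c F → F (suc K) ≈ 𝟘 → evalAtQ (suc (suc K)) (c ·ᶻ F ⊕ᶻ z· F) ≈ (c ⊕ q^ 1) ⊗ evalAtQ (suc K) F
evalAtQ-step₋ K c F top≈𝟘 = begin
  evalAtQ (suc (suc K)) (c ·ᶻ F ⊕ᶻ z· F)
    ≈⟨ evalAtQ-⊕ᶻ (suc (suc K)) (c ·ᶻ F) (z· F) ⟩
  evalAtQ (suc (suc K)) (c ·ᶻ F) ⊕ evalAtQ (suc (suc K)) (z· F)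
    ≈⟨ ⊕-cong (evalAtQ-·ᶻ (suc (suc K)) c F) (evalAtQ-z· (suc K) F) ⟩
  c ⊗ evalAtQ (suc (suc K)) F ⊕ q^ 1 ⊗ S
    ≈⟨ ⊕-congʳ (q^ 1 ⊗ S) (⊗-congˡ c (evalAtQ-top (suc K) F top≈𝟘)) ⟩
  c ⊗ S ⊕ q^ 1 ⊗ S
    ≈⟨ ≈-sym (⊗-distribʳ-⊕ c (q^ 1) S) ⟩
  (c ⊕ q^ 1) ⊗ S  ∎
  where
  open ≈-Reasoning
  S = evalAtQ (suc K) F

-- ∏_{i<a} (1 + z q^{4i+2})
jacobi₊ : ℕ → ZPoly
jacobi₊ zero    = 1ᶻ
jacobi₊ (suc a) = jacobi₊ a ⊕ᶻ q^ (2 + 4 * a) ·ᶻ z· jacobi₊ a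

-- ∏_{i<a} (1 + z q^{4i+2}) ∏_{i<b} (z + q^{4i+2})
jacobi : ℕ → ℕ → ZPoly
jacobi a zero    = jacobi₊ a
jacobi a (suc b) = q^ (2 + 4 * b) ·ᶻ jacobi a b ⊕ᶻ z· jacobi a b

jacobi₊-vanish : ∀ a j → a < j → jacobi₊ a j ≈ 𝟘
jacobi₊-vanish zero    (suc j) _         = ≈-refl
jacobi₊-vanish (suc a) (suc j) (s≤s a<j) =
  ≈-trans (⊕-cong (jacobi₊-vanish a (suc j) (m<n⇒m<1+n a<j))
                  (≈-trans (⊗-congˡ (q^ (2 + 4 * a)) (jacobi₊-vanish a j a<j)) (⊗-zeroʳ _)))
          (⊕-identityʳ 𝟘)

jacobi-vanish : ∀ a b j → a + b < j → jacobi a b j ≈ 𝟘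
jacobi-vanish a zero    j       a+0<j = jacobi₊-vanish a j (subst (_< j) (+-identityʳ a) a+0<j)
jacobi-vanish a (suc b) (suc j) a+b+1<j+1 =
  ≈-trans (⊕-cong (≈-trans (⊗-congˡ (q^ (2 + 4 * b)) (jacobi-vanish a b (suc j) (m<n⇒m<1+n a+b<j))) (⊗-zeroʳ _))
                  (jacobi-vanish a b j a+b<j))
          (⊕-identityʳ 𝟘)
  where
  a+b<j : a + b < j
  a+b<j = ≤-pred (subst (_< suc j) (+-suc a b) a+b+1<j+1)

evalAtQ-jacobi₊ : ∀ a → evalAtQ (suc a) (jacobi₊ a) ≈ ∏₄ 3 a
evalAtQ-jacobi₊ zero    = ⊗-identityˡ 𝟙
evalAtQ-jacobi₊ (suc a) = begin
  evalAtQ (suc (suc a)) (jacobi₊ (suc a))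
    ≈⟨ evalAtQ-step₊ a (q^ (2 + 4 * a)) (jacobi₊ a) (jacobi₊-vanish a (suc a) ≤-refl) ⟩
  (𝟙 ⊕ q^ (2 + 4 * a) ⊗ q^ 1) ⊗ evalAtQ (suc a) (jacobi₊ a)
    ≈⟨ ⊗-cong (⊕-congˡ 𝟙 (≈-trans (≈-sym (q^-+ (2 + 4 * a) 1)) (≡⇒≈ (cong q^_ (exponent a))))) (evalAtQ-jacobi₊ a) ⟩
  1+q^ (3 + 4 * a) ⊗ ∏₄ 3 a
    ≈⟨ ⊗-comm _ _ ⟩
  ∏₄ 3 (suc a)  ∎
  where
  open ≈-Reasoning
  exponent : ∀ a → 2 + 4 * a + 1 ≡ 3 + 4 * a
  exponent = solve-∀

evalAtQ-jacobi : ∀ a b → evalAtQ (suc (a + b)) (jacobi a b) ≈ q^ b ⊗ (∏₄ 3 a ⊗ ∏₄ 1 b)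
evalAtQ-jacobi a zero = begin
  evalAtQ (suc (a + 0)) (jacobi₊ a)  ≈⟨ ∑-≡ _ (cong suc (+-identityʳ a)) ⟩
  evalAtQ (suc a) (jacobi₊ a)        ≈⟨ evalAtQ-jacobi₊ a ⟩
  ∏₄ 3 a                             ≈⟨ ≈-sym (≈-trans (⊗-identityˡ _) (⊗-identityʳ _)) ⟩
  𝟙 ⊗ (∏₄ 3 a ⊗ 𝟙)                   ∎
  where open ≈-Reasoning
evalAtQ-jacobi a (suc b) = begin
  evalAtQ (suc (a + suc b)) (jacobi a (suc b))
    ≈⟨ ∑-≡ _ (cong suc (+-suc a b)) ⟩
  evalAtQ (suc (suc (a + b))) (jacobi a (suc b))
    ≈⟨ evalAtQ-step₋ (a + b) (q^ (2 + 4 * b)) (jacobi a b) (jacobi-vanish a b (suc (a + b)) ≤-refl) ⟩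
  (q^ (2 + 4 * b) ⊕ q^ 1) ⊗ evalAtQ (suc (a + b)) (jacobi a b)
    ≈⟨ ⊗-cong (⊕-congʳ (q^ 1) (q^-+ 1 (1 + 4 * b))) (evalAtQ-jacobi a b) ⟩
  (q^ 1 ⊗ y ⊕ q^ 1) ⊗ (q^ b ⊗ (∏₄ 3 a ⊗ ∏₄ 1 b))
    ≈⟨ regroup (q^ 1) y (q^ b) (∏₄ 3 a) (∏₄ 1 b) ⟩
  (q^ 1 ⊗ q^ b) ⊗ (∏₄ 3 a ⊗ (∏₄ 1 b ⊗ (𝟙 ⊕ y)))
    ≈⟨ ⊗-congʳ _ (≈-sym (q^-+ 1 b)) ⟩
  q^ (suc b) ⊗ (∏₄ 3 a ⊗ ∏₄ 1 (suc b))  ∎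
  where
  open ≈-Reasoning
  y = q^ (1 + 4 * b)
  regroup : ∀ q y x A B → (q ⊗ y ⊕ q) ⊗ (x ⊗ (A ⊗ B)) ≈ (q ⊗ x) ⊗ (A ⊗ (B ⊗ (𝟙 ⊕ y)))
  regroup = solve 5 (λ q y x A B →
    (q :* y :+ q) :* (x :* (A :* B)) := (q :* x) :* (A :* (B :* (con 1ℙ :+ y)))) (λ _ → refl)

jacobi₊-closed : ∀ j r → jacobi₊ (j + r) j ≈ q^ (2 * (j * j)) ⊗ gauss₄ j r
jacobi₊-closed zero    zero    = ≈-sym (⊗-identityˡ 𝟙)
jacobi₊-closed zero    (suc r) = ≈-trans (⊕-cong (jacobi₊-closed zero r) (⊗-zeroʳ (q^ (2 + 4 * r)))) (⊕-identityʳ (𝟙 ⊗ 𝟙))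
jacobi₊-closed (suc i) zero    = begin
  jacobi₊ (i + 0) (suc i) ⊕ c ⊗ jacobi₊ (i + 0) i
    ≈⟨ ⊕-cong (jacobi₊-vanish (i + 0) (suc i) (s≤s (≤-reflexive (+-identityʳ i)))) (⊗-congˡ c (jacobi₊-closed i 0)) ⟩
  𝟘 ⊕ c ⊗ (q^ (2 * (i * i)) ⊗ gauss₄ i 0)
    ≈⟨ ⊗-congˡ c (⊗-congˡ (q^ (2 * (i * i))) (gauss₄-zeroʳ i)) ⟩
  c ⊗ (q^ (2 * (i * i)) ⊗ 𝟙)
    ≈⟨ ≈-sym (⊗-assoc c (q^ (2 * (i * i))) 𝟙) ⟩
  (c ⊗ q^ (2 * (i * i))) ⊗ 𝟙
    ≈⟨ ⊗-congʳ 𝟙 (≈-trans (≈-sym (q^-+ (2 + 4 * (i + 0)) (2 * (i * i)))) (≡⇒≈ (cong q^_ (exponent i)))) ⟩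
  q^ (2 * (suc i * suc i)) ⊗ gauss₄ (suc i) 0  ∎
  where
  open ≈-Reasoning
  c = q^ (2 + 4 * (i + 0))
  exponent : ∀ i → 2 + 4 * (i + 0) + 2 * (i * i) ≡ 2 * (suc i * suc i)
  exponent = solve-∀
jacobi₊-closed (suc i) (suc r) = begin
  jacobi₊ (i + suc r) (suc i) ⊕ c ⊗ jacobi₊ (i + suc r) i
    ≈⟨ ⊕-cong (≈-trans (≡⇒≈ (cong (λ a → jacobi₊ a (suc i)) (+-suc i r))) (jacobi₊-closed (suc i) r))
              (⊗-congˡ c (jacobi₊-closed i (suc r))) ⟩
  X ⊗ G₁ ⊕ c ⊗ (q^ (2 * (i * i)) ⊗ gauss₄ i (suc r))
    ≈⟨ ⊕-congˡ (X ⊗ G₁) (≈-sym (⊗-assoc c (q^ (2 * (i * i))) G₂)) ⟩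
  X ⊗ G₁ ⊕ (c ⊗ q^ (2 * (i * i))) ⊗ G₂
    ≈⟨ ⊕-congˡ (X ⊗ G₁) (⊗-congʳ G₂
         (q^⊗q^-≡ (2 + 4 * (i + suc r)) (2 * (i * i)) (2 * (suc i * suc i)) (4 + 4 * r) (exponent i r))) ⟩
  X ⊗ G₁ ⊕ (X ⊗ q^ (4 + 4 * r)) ⊗ G₂
    ≈⟨ factor X G₁ (q^ (4 + 4 * r)) G₂ ⟩
  X ⊗ (G₁ ⊕ q^ (4 + 4 * r) ⊗ G₂)
    ≈⟨ ⊗-congˡ X (≈-sym (gauss₄-pascal i r)) ⟩
  X ⊗ gauss₄ (suc i) (suc r)  ∎
  where
  open ≈-Reasoning
  c = q^ (2 + 4 * (i + suc r))
  X = q^ (2 * (suc i * suc i))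
  G₁ = gauss₄ (suc i) r
  G₂ = gauss₄ i (suc r)
  exponent : ∀ i r → 2 + 4 * (i + suc r) + 2 * (i * i) ≡ 2 * (suc i * suc i) + (4 + 4 * r)
  exponent = solve-∀
  factor : ∀ X G₁ b G₂ → X ⊗ G₁ ⊕ (X ⊗ b) ⊗ G₂ ≈ X ⊗ (G₁ ⊕ b ⊗ G₂)
  factor = solve 4 (λ X G₁ b G₂ → X :* G₁ :+ (X :* b) :* G₂ := X :* (G₁ :+ b :* G₂)) (λ _ → refl)

δ : ℕ → ℕ → ℕ
δ j b = 2 * (∣ j - b ∣ * ∣ j - b ∣)

δ-step : ∀ i b → (2 + 4 * b) + δ (suc i) b ≡ δ i b + (4 + 4 * i)
δ-step i zero = trans (square i) (cong (λ d → 2 * (d * d) + (4 + 4 * i)) (sym (∣-∣-identityʳ i)))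
  where
  square : ∀ i → 2 + 4 * 0 + 2 * (suc i * suc i) ≡ 2 * (i * i) + (4 + 4 * i)
  square = solve-∀
δ-step zero (suc b) = square b
  where
  square : ∀ b → 2 + 4 * suc b + 2 * (b * b) ≡ 2 * (suc b * suc b) + (4 + 4 * 0)
  square = solve-∀
δ-step (suc i) (suc b) = begin
  (2 + 4 * suc b) + δ (suc i) b    ≡⟨ shiftˡ b (δ (suc i) b) ⟩
  4 + ((2 + 4 * b) + δ (suc i) b)  ≡⟨ cong (4 +_) (δ-step i b) ⟩
  4 + (δ i b + (4 + 4 * i))        ≡⟨ shiftʳ (δ i b) i ⟩
  δ i b + (4 + 4 * suc i)          ∎
  where
  open ≡-Reasoning
  shiftˡ : ∀ b d → (2 + 4 * suc b) + d ≡ 4 + ((2 + 4 * b) + d)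
  shiftˡ = solve-∀
  shiftʳ : ∀ d i → 4 + (d + (4 + 4 * i)) ≡ d + (4 + 4 * suc i)
  shiftʳ = solve-∀

jacobi-closed : ∀ a b j r → j + r ≡ a + b → jacobi a b j ≈ q^ (δ j b) ⊗ gauss₄ j r
jacobi-closed a zero j r j+r≡a+0 = begin
  jacobi₊ a j                    ≈⟨ ≡⇒≈ (cong (λ a → jacobi₊ a j) (trans (sym (+-identityʳ a)) (sym j+r≡a+0))) ⟩
  jacobi₊ (j + r) j              ≈⟨ jacobi₊-closed j r ⟩
  q^ (2 * (j * j)) ⊗ gauss₄ j r  ≈⟨ ⊗-congʳ (gauss₄ j r) (≡⇒≈ (cong (λ d → q^ (2 * (d * d))) (sym (∣-∣-identityʳ j)))) ⟩
  q^ (δ j 0) ⊗ gauss₄ j r        ∎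
  where open ≈-Reasoning
jacobi-closed a (suc b) zero r _ = begin
  c ⊗ jacobi a b 0 ⊕ 𝟘           ≈⟨ ⊕-identityʳ (c ⊗ jacobi a b 0) ⟩
  c ⊗ jacobi a b 0               ≈⟨ ⊗-congˡ c (jacobi-closed a b 0 (a + b) refl) ⟩
  c ⊗ (q^ (δ 0 b) ⊗ 𝟙)           ≈⟨ ≈-sym (⊗-assoc c (q^ (δ 0 b)) 𝟙) ⟩
  (c ⊗ q^ (δ 0 b)) ⊗ 𝟙           ≈⟨ ⊗-congʳ 𝟙 (≈-trans (≈-sym (q^-+ (2 + 4 * b) (δ 0 b))) (≡⇒≈ (cong q^_ (exponent b)))) ⟩
  q^ (δ 0 (suc b)) ⊗ gauss₄ 0 r  ∎
  where
  open ≈-Reasoning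
  c = q^ (2 + 4 * b)
  exponent : ∀ b → 2 + 4 * b + 2 * (b * b) ≡ 2 * (suc b * suc b)
  exponent = solve-∀
jacobi-closed a (suc b) (suc i) zero i+1+0≡a+b+1 = begin
  c ⊗ jacobi a b (suc i) ⊕ jacobi a b i   ≈⟨ ⊕-cong (≈-trans (⊗-congˡ c (jacobi-vanish a b (suc i) a+b<i+1)) (⊗-zeroʳ c))
                                                    (jacobi-closed a b i 0 i+0≡a+b) ⟩
  𝟘 ⊕ q^ (δ i b) ⊗ gauss₄ i 0  ≈⟨ ⊗-congˡ (q^ (δ i b)) (gauss₄-zeroʳ i) ⟩
  q^ (δ i b) ⊗ 𝟙               ∎
  where
  open ≈-Reasoning
  c = q^ (2 + 4 * b)
  i+0≡a+b : i + 0 ≡ a + b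
  i+0≡a+b = suc-injective (trans i+1+0≡a+b+1 (+-suc a b))
  a+b<i+1 : a + b < suc i
  a+b<i+1 = s≤s (≤-reflexive (trans (sym i+0≡a+b) (+-identityʳ i)))
jacobi-closed a (suc b) (suc i) (suc r) i+1+r+1≡a+b+1 = begin
  c ⊗ jacobi a b (suc i) ⊕ jacobi a b i
    ≈⟨ ⊕-cong (⊗-congˡ c (jacobi-closed a b (suc i) r (trans (sym (+-suc i r)) i+r+1≡a+b)))
              (jacobi-closed a b i (suc r) i+r+1≡a+b) ⟩
  c ⊗ (q^ (δ (suc i) b) ⊗ G₁) ⊕ Y ⊗ G₂
    ≈⟨ ⊕-congʳ (Y ⊗ G₂) (≈-sym (⊗-assoc c (q^ (δ (suc i) b)) G₁)) ⟩
  (c ⊗ q^ (δ (suc i) b)) ⊗ G₁ ⊕ Y ⊗ G₂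
    ≈⟨ ⊕-congʳ (Y ⊗ G₂) (⊗-congʳ G₁ (q^⊗q^-≡ (2 + 4 * b) (δ (suc i) b) (δ i b) (4 + 4 * i) (δ-step i b))) ⟩
  (Y ⊗ q^ (4 + 4 * i)) ⊗ G₁ ⊕ Y ⊗ G₂
    ≈⟨ factor Y (q^ (4 + 4 * i)) G₁ G₂ ⟩
  Y ⊗ gauss₄ (suc i) (suc r)  ∎
  where
  open ≈-Reasoning
  c = q^ (2 + 4 * b)
  Y = q^ (δ i b)
  G₁ = gauss₄ (suc i) r
  G₂ = gauss₄ i (suc r)
  i+r+1≡a+b : i + suc r ≡ a + b
  i+r+1≡a+b = suc-injective (trans i+1+r+1≡a+b+1 (+-suc a b))
  factor : ∀ Y a G₁ G₂ → (Y ⊗ a) ⊗ G₁ ⊕ Y ⊗ G₂ ≈ Y ⊗ (a ⊗ G₁ ⊕ G₂)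
  factor = solve 4 (λ Y a G₁ G₂ → (Y :* a) :* G₁ :+ Y :* G₂ := Y :* (a :* G₁ :+ G₂)) (λ _ → refl)

jacobi-triple-product : ∀ N →
  q^ N ⊗ (∏₄ 3 N ⊗ ∏₄ 1 N) ≈ ∑ (suc (N + N)) (λ j → q^ j ⊗ (q^ (δ j N) ⊗ gauss₄ j (N + N ∸ j)))
jacobi-triple-product N = ≈-trans (≈-sym (evalAtQ-jacobi N N))
  (∑-cong (suc (N + N)) (λ j j≤2N → ⊗-congˡ (q^ j) (jacobi-closed N N j (N + N ∸ j) (m+[n∸m]≡n (≤-pred j≤2N)))))

triangle : ℕ → ℕ
triangle zero    = 0
triangle (suc k) = triangle k + suc k

triangle-double : ∀ k → 2 * triangle k ≡ k * suc k
triangle-double zero    = refl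
triangle-double (suc k) = begin
  2 * (triangle k + suc k)    ≡⟨ *-distribˡ-+ 2 (triangle k) (suc k) ⟩
  2 * triangle k + 2 * suc k  ≡⟨ cong (_+ 2 * suc k) (triangle-double k) ⟩
  k * suc k + 2 * suc k       ≡⟨ step k ⟩
  suc k * suc (suc k)         ∎
  where
  open ≡-Reasoning
  step : ∀ k → k * suc k + 2 * suc k ≡ suc k * suc (suc k)
  step = solve-∀

triangle-even : ∀ k → triangle (k * 2) ≡ k + 2 * (k * k)
triangle-even k = *-cancelˡ-≡ _ _ 2 (trans (triangle-double (k * 2)) (square k))
  where
  square : ∀ k → k * 2 * suc (k * 2) ≡ 2 * (k + 2 * (k * k))
  square = solve-∀

triangle-odd : ∀ t → triangle (t * 2 + 1) ≡ suc t + 2 * (t * t + t)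
triangle-odd t = *-cancelˡ-≡ _ _ 2 (trans (triangle-double (t * 2 + 1)) (square t))
  where
  square : ∀ t → (t * 2 + 1) * suc (t * 2 + 1) ≡ 2 * (suc t + 2 * (t * t + t))
  square = solve-∀

triangle-≥ : ∀ k → k ≤ triangle k
triangle-≥ zero    = z≤n
triangle-≥ (suc k) = m≤n+m (suc k) (triangle k)

ψ : ℕ → Series
ψ K = ∑ K (λ k → q^ (triangle k))

δ-lower : ∀ j N → N + ∣ j - N ∣ ≤ j + δ j N
δ-lower j N = begin
  N + d        ≤⟨ +-monoˡ-≤ d (m≤n+∣n-m∣ N j) ⟩
  j + d + d    ≡⟨ +-assoc j d d ⟩
  j + (d + d)  ≤⟨ +-monoʳ-≤ j (+-mono-≤ (n≤n*n d) (subst (d ≤_) (sym (+-identityʳ (d * d))) (n≤n*n d))) ⟩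
  j + δ j N    ∎
  where
  open ≤-Reasoning
  d = ∣ j - N ∣
  n≤n*n : ∀ n → n ≤ n * n
  n≤n*n zero        = z≤n
  n≤n*n n@(suc _)   = m≤m*n n n

δ-above : ∀ N k → N + k + δ (N + k) N ≡ N + triangle (k * 2)
δ-above N k = begin
  N + k + δ (N + k) N    ≡⟨ cong (λ d → N + k + 2 * (d * d)) (trans (∣-∣-comm (N + k) N) (∣m-m+n∣≡n N k)) ⟩
  N + k + 2 * (k * k)    ≡⟨ +-assoc N k (2 * (k * k)) ⟩
  N + (k + 2 * (k * k))  ≡⟨ cong (N +_) (sym (triangle-even k)) ⟩
  N + triangle (k * 2)   ∎
  where open ≡-Reasoning

δ-below : ∀ j t → j + δ j (j + suc t) ≡ (j + suc t) + triangle (t * 2 + 1)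
δ-below j t = begin
  j + δ j (j + suc t)                      ≡⟨ cong (λ d → j + 2 * (d * d)) (∣m-m+n∣≡n j (suc t)) ⟩
  j + 2 * (suc t * suc t)                  ≡⟨ expand j t ⟩
  (j + suc t) + (suc t + 2 * (t * t + t))  ≡⟨ cong ((j + suc t) +_) (sym (triangle-odd t)) ⟩
  (j + suc t) + triangle (t * 2 + 1)       ∎
  where
  open ≡-Reasoning
  expand : ∀ j t → j + 2 * (suc t * suc t) ≡ (j + suc t) + (suc t + 2 * (t * t + t))
  expand = solve-∀

∑-q^[j+δ] : ∀ N → ∑ (suc (N + N)) (λ j → q^ (j + δ j N)) ≈ q^ N ⊗ ψ (suc (N + N))
∑-q^[j+δ] N = begin
  ∑ (suc (N + N)) g
    ≈⟨ ∑-≡ g (sym (+-suc N N)) ⟩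
  ∑ (N + suc N) g
    ≈⟨ ∑-+ N (suc N) g ⟩
  ∑ N g ⊕ ∑ (suc N) (λ k → g (N + k))
    ≈⟨ ⊕-congʳ (∑ (suc N) (λ k → g (N + k))) (∑-reverse N g) ⟩
  ∑ N (λ t → g (N ∸ suc t)) ⊕ ∑ (suc N) (λ k → g (N + k))
    ≈⟨ ⊕-cong (∑-cong N (λ t t<N → below t t<N)) (∑-cong (suc N) (λ k _ → above k)) ⟩
  ∑ N (λ t → q^ N ⊗ T (t * 2 + 1)) ⊕ ∑ (suc N) (λ k → q^ N ⊗ T (k * 2))
    ≈⟨ ≈-sym (⊕-cong (⊗-∑ N (q^ N) (λ t → T (t * 2 + 1))) (⊗-∑ (suc N) (q^ N) (λ k → T (k * 2)))) ⟩
  q^ N ⊗ O ⊕ q^ N ⊗ E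
    ≈⟨ factor (q^ N) O E ⟩
  q^ N ⊗ (E ⊕ O)
    ≈⟨ ⊗-congˡ (q^ N) (≈-sym (∑-even-odd N T)) ⟩
  q^ N ⊗ ψ (suc (N + N))  ∎
  where
  open ≈-Reasoning
  g : ℕ → Series
  g j = q^ (j + δ j N)
  T : ℕ → Series
  T k = q^ (triangle k)
  E = ∑ (suc N) (λ k → T (k * 2))
  O = ∑ N (λ t → T (t * 2 + 1))
  factor : ∀ x O E → x ⊗ O ⊕ x ⊗ E ≈ x ⊗ (E ⊕ O)
  factor = solve 3 (λ x O E → x :* O :+ x :* E := x :* (E :+ O)) (λ _ → refl)
  above : ∀ k → g (N + k) ≈ q^ N ⊗ T (k * 2)
  above k = ≈-trans (≡⇒≈ (cong q^_ (δ-above N k))) (q^-+ N (triangle (k * 2)))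
  below : ∀ t → t < N → g (N ∸ suc t) ≈ q^ N ⊗ T (t * 2 + 1)
  below t t<N = ≈-trans (≡⇒≈ (cong q^_ exponent)) (q^-+ N (triangle (t * 2 + 1)))
    where
    j+t+1≡N : N ∸ suc t + suc t ≡ N
    j+t+1≡N = trans (+-comm (N ∸ suc t) (suc t)) (m+[n∸m]≡n t<N)
    exponent : N ∸ suc t + δ (N ∸ suc t) N ≡ N + triangle (t * 2 + 1)
    exponent = subst (λ n → N ∸ suc t + δ (N ∸ suc t) n ≡ n + triangle (t * 2 + 1)) j+t+1≡N (δ-below (N ∸ suc t) t)

ψ-truncate : ∀ n d → ψ (suc n + d) ≈[ suc n ] ψ (suc n)
ψ-truncate n d = begin
  ψ (suc n + d)                                      ≈⟨ ≈⇒≈[] (∑-+ (suc n) d (λ k → q^ (triangle k))) ⟩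
  ψ (suc n) ⊕ ∑ d (λ k → q^ (triangle (suc n + k)))  ≈⟨ ⊕-cong[] {f = ψ (suc n)} (λ _ _ → refl) tail≈𝟘 ⟩
  ψ (suc n) ⊕ 𝟘                                      ≈⟨ ≈⇒≈[] (⊕-identityʳ (ψ (suc n))) ⟩
  ψ (suc n)                                          ∎
  where
  open ≈[]-Reasoning (suc n)
  tail≈𝟘 : ∑ d (λ k → q^ (triangle (suc n + k))) ≈[ suc n ] 𝟘
  tail≈𝟘 = ∑-≈[]-𝟘 d _ (λ k _ → q^-≈[]-𝟘 _ (≤-trans (m≤m+n (suc n) k) (triangle-≥ (suc n + k))))

-- N = 2n is large enough that modulo q^{N+n+1} the Jacobi sum keeps only the
-- terms with ∣j - N∣ ≤ n, and for those the Gaussian binomial times (q⁴; q⁴)_{2N} is 1.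
module _ (n : ℕ) where

  private
    N = n + n

  jacobi-term-≈[] : ∀ j → j ≤ N + N →
    q^ (j + δ j N) ⊗ (gauss₄ j (N + N ∸ j) ⊗ pochhammer₄ (N + N)) ≈[ N + suc n ] q^ (j + δ j N)
  jacobi-term-≈[] j j≤2N with suc n ≤? ∣ j - N ∣
  ... | yes n<d = λ m m<K → trans (q^⊗-≈[]-𝟘 e X N+n<e m m<K) (sym (q^-≈[]-𝟘 e N+n<e m m<K))
    where
    e = j + δ j N
    X = gauss₄ j (N + N ∸ j) ⊗ pochhammer₄ (N + N)
    N+n<e : N + suc n ≤ e
    N+n<e = ≤-trans (+-monoʳ-≤ N n<d) (δ-lower j N)
  ... | no  n≮d = ≈[]-weaken (+-monoˡ-≤ (suc n) N≤e)
                   (λ m m<K → trans (q^⊗-cong[] e X≈𝟙 m m<K) (⊗-identityʳ (q^ e) m))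
    where
    e = j + δ j N
    d≤n : ∣ j - N ∣ ≤ n
    d≤n = ≤-pred (≰⇒> n≮d)
    N≤e : N ≤ e
    N≤e = ≤-trans (m≤m+n N ∣ j - N ∣) (δ-lower j N)
    n≤j : n ≤ j
    n≤j = +-cancelʳ-≤ n n j (≤-trans (m≤n+∣n-m∣ N j) (+-monoʳ-≤ j d≤n))
    n≤N+N∸j : n ≤ N + N ∸ j
    n≤N+N∸j = m+n≤o⇒m≤o∸n n (subst (n + j ≤_) (+-assoc N n n) (subst (_≤ N + n + n) (+-comm j n)
                (+-monoˡ-≤ n (≤-trans (m≤n+∣m-n∣ j N) (+-monoʳ-≤ N d≤n)))))
    X≈𝟙 : gauss₄ j (N + N ∸ j) ⊗ pochhammer₄ (N + N) ≈[ suc n ] 𝟙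
    X≈𝟙 = gauss₄⊗pochhammer₄-≈[]-𝟙 j (N + N ∸ j) (N + N) j≤2N (s≤s-≤-4+4* n≤N+N∸j) (s≤s-≤-4+4* n≤j)
      where
      s≤s-≤-4+4* : ∀ {a b} → a ≤ b → suc a ≤ 4 + 4 * b
      s≤s-≤-4+4* {a} {b} a≤b = ≤-trans (s≤s a≤b) (≤-trans (s≤s (m≤n+m b 3)) (+-monoʳ-≤ 4 (m≤n*m b 4)))

  private
    AB = ∏₄ 3 N ⊗ ∏₄ 1 N
    P = pochhammer₄ (N + N)

    summand : ℕ → Series
    summand j = q^ (j + δ j N) ⊗ (gauss₄ j (N + N ∸ j) ⊗ P)

  jacobi-triple-product-pochhammer₄ : q^ N ⊗ (AB ⊗ P) ≈ ∑ (suc (N + N)) summand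
  jacobi-triple-product-pochhammer₄ = begin
    q^ N ⊗ (AB ⊗ P)                   ≈⟨ ≈-sym (⊗-assoc (q^ N) AB P) ⟩
    (q^ N ⊗ AB) ⊗ P                   ≈⟨ ⊗-congʳ P (jacobi-triple-product N) ⟩
    ∑ (suc (N + N)) jt ⊗ P            ≈⟨ ⊗-comm (∑ (suc (N + N)) jt) P ⟩
    P ⊗ ∑ (suc (N + N)) jt            ≈⟨ ⊗-∑ (suc (N + N)) P jt ⟩
    ∑ (suc (N + N)) (λ j → P ⊗ jt j)  ≈⟨ ∑-cong (suc (N + N)) (λ j _ → regroup j) ⟩
    ∑ (suc (N + N)) summand           ∎
    where
    open ≈-Reasoning
    jt : ℕ → Series
    jt j = q^ j ⊗ (q^ (δ j N) ⊗ gauss₄ j (N + N ∸ j))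
    rearrange : ∀ P x y G → P ⊗ (x ⊗ (y ⊗ G)) ≈ (x ⊗ y) ⊗ (G ⊗ P)
    rearrange = solve 4 (λ P x y G → P :* (x :* (y :* G)) := (x :* y) :* (G :* P)) (λ _ → refl)
    regroup : ∀ j → P ⊗ jt j ≈ summand j
    regroup j = ≈-trans (rearrange P (q^ j) (q^ (δ j N)) (gauss₄ j (N + N ∸ j)))
                        (⊗-congʳ (gauss₄ j (N + N ∸ j) ⊗ P) (≈-sym (q^-+ j (δ j N))))

  ψ≈[]∏ : ψ (suc n) ≈[ suc n ] AB ⊗ P
  ψ≈[]∏ = begin
    ψ (suc n)        ≈⟨ ≈[]-sym (subst (λ K → ψ K ≈[ suc n ] ψ (suc n)) n+[2N∸n]≡2N (ψ-truncate n (N + N ∸ n))) ⟩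
    ψ (suc (N + N))  ≈⟨ ≈[]-sym (q^⊗-cancel[] N multiplied) ⟩
    AB ⊗ P           ∎
    where
    open ≈[]-Reasoning (suc n)
    n+[2N∸n]≡2N : suc n + (N + N ∸ n) ≡ suc (N + N)
    n+[2N∸n]≡2N = cong suc (m+[n∸m]≡n (≤-trans (m≤m+n n n) (m≤m+n N N)))
    multiplied : q^ N ⊗ (AB ⊗ P) ≈[ N + suc n ] q^ N ⊗ ψ (suc (N + N))
    multiplied = ≈[]-trans (≈⇒≈[] jacobi-triple-product-pochhammer₄)
      (≈[]-trans (∑-cong[] (suc (N + N)) summand (λ j → q^ (j + δ j N)) (λ j j<2N+1 → jacobi-term-≈[] j (≤-pred j<2N+1)))
                 (≈⇒≈[] (∑-q^[j+δ] N)))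

-- Partitions modulo 2

⟦_⟧ : Bool → Parity
⟦ true  ⟧ = 1ℙ
⟦ false ⟧ = 0ℙ

⟦∧⟧ : ∀ a b → ⟦ a ∧ b ⟧ ≡ ⟦ a ⟧ *ₚ ⟦ b ⟧
⟦∧⟧ true  b = refl
⟦∧⟧ false b = refl

optionalFactor : Bool → ℕ → Series
optionalFactor b d = 𝟙 ⊕ scale ⟦ b ⟧ (q^ suc d)

optionalFactor⁻¹ : Bool → ℕ → Series
optionalFactor⁻¹ true  d = geometric (suc d)
optionalFactor⁻¹ false d = 𝟙

optionalFactor-inverse : ∀ b d → optionalFactor b d ⊗ optionalFactor⁻¹ b d ≈ 𝟙
optionalFactor-inverse true  d = 1+q^⊗geometric (suc d)
optionalFactor-inverse false d = ≈-trans (⊗-identityʳ (optionalFactor false d)) (⊕-identityʳ 𝟙)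

optionalFactor-≈[]-𝟙 : ∀ {K} b d → K ≤ suc d → optionalFactor b d ≈[ K ] 𝟙
optionalFactor-≈[]-𝟙 true  d K≤d+1 = 1+q^-≈[]-𝟙 (suc d) K≤d+1
optionalFactor-≈[]-𝟙 false d _     = ≈⇒≈[] (⊕-identityʳ 𝟙)

optionalFactor⁻¹-≈[]-𝟙 : ∀ b d → optionalFactor⁻¹ b d ≈[ suc d ] 𝟙
optionalFactor⁻¹-≈[]-𝟙 true  d = geometric-≈[]-𝟙 d
optionalFactor⁻¹-≈[]-𝟙 false d = λ _ _ → refl

module PartitionParity {ℓ : Level} {P : Pred ℕ ℓ} (P? : Decidable P) where

  count : List (List ℕ) → Parity
  count xss = parity (length (filter (all? P?) xss))

  count-∷ : ∀ xs xss → count (xs ∷ xss) ≡ ⟦ does (all? P? xs) ⟧ +ₚ count xss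
  count-∷ xs xss with does (all? P? xs)
  ... | true  = +-homo-+ 1 (length (filter (all? P?) xss))
  ... | false = refl

  count-++ : ∀ xss yss → count (xss ++ yss) ≡ count xss +ₚ count yss
  count-++ xss yss = begin
    parity (length (filter (all? P?) (xss ++ yss)))
      ≡⟨ cong (parity ∘ length) (filter-++ (all? P?) xss yss) ⟩
    parity (length (filter (all? P?) xss ++ filter (all? P?) yss))
      ≡⟨ cong parity (length-++ (filter (all? P?) xss)) ⟩
    parity (length (filter (all? P?) xss) + length (filter (all? P?) yss))
      ≡⟨ +-homo-+ (length (filter (all? P?) xss)) (length (filter (all? P?) yss)) ⟩
    count xss +ₚ count yss  ∎
    where
    open ≡-Reasoning

  count-map-∷ : ∀ x yss → count (map (x ∷_) yss) ≡ ⟦ does (P? x) ⟧ *ₚ count yss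
  count-map-∷ x []         = sym (*ₚ-zeroʳ ⟦ does (P? x) ⟧)
  count-map-∷ x (ys ∷ yss) = begin
    count (map (x ∷_) (ys ∷ yss))
      ≡⟨ count-∷ (x ∷ ys) (map (x ∷_) yss) ⟩
    ⟦ does (P? x) ∧ does (all? P? ys) ⟧ +ₚ count (map (x ∷_) yss)
      ≡⟨ cong₂ _+ₚ_ (⟦∧⟧ (does (P? x)) (does (all? P? ys))) (count-map-∷ x yss) ⟩
    ⟦ does (P? x) ⟧ *ₚ ⟦ does (all? P? ys) ⟧ +ₚ ⟦ does (P? x) ⟧ *ₚ count yss
      ≡⟨ sym (*ₚ-distribˡ-+ₚ ⟦ does (P? x) ⟧ ⟦ does (all? P? ys) ⟧ (count yss)) ⟩
    ⟦ does (P? x) ⟧ *ₚ (⟦ does (all? P? ys) ⟧ +ₚ count yss)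
      ≡⟨ cong (⟦ does (P? x) ⟧ *ₚ_) (sym (count-∷ ys yss)) ⟩
    ⟦ does (P? x) ⟧ *ₚ count (ys ∷ yss)  ∎
    where open ≡-Reasoning

  allowed : ℕ → Bool
  allowed p = does (P? p)

  -- ∏_{p ≤ M, P p} (1 + q^p)⁻¹, the generating function of partitions into allowed parts ≤ M.
  partitionSeries : ℕ → Series
  partitionSeries M = ∏ M (λ i → optionalFactor⁻¹ (allowed (suc i)) i)

  partitionSeries⁻¹ : ℕ → Series
  partitionSeries⁻¹ M = ∏ M (λ i → optionalFactor (allowed (suc i)) i)

  partitionSeries-inverse : ∀ M → partitionSeries⁻¹ M ⊗ partitionSeries M ≈ 𝟙
  partitionSeries-inverse M = ∏-inverse M _ _ (λ i → optionalFactor-inverse (allowed (suc i)) i)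

  partitionSeries-zero : ∀ M → partitionSeries M 0 ≡ 1ℙ
  partitionSeries-zero zero    = refl
  partitionSeries-zero (suc M) = cong₂ _*ₚ_ (partitionSeries-zero M) (constant-term (allowed (suc M)))
    where
    constant-term : ∀ b → optionalFactor⁻¹ b M 0 ≡ 1ℙ
    constant-term true  = refl
    constant-term false = refl

  partitionSeries-suc : ∀ M k →
    partitionSeries (suc M) k ≡ partitionSeries M k +ₚ ⟦ allowed (suc M) ⟧ *ₚ (q^ suc M ⊗ partitionSeries (suc M)) k
  partitionSeries-suc M k =
    trans (⊗-inverse-recursion F⊗next≈current k)
          (cong (partitionSeries M k +ₚ_) (⊗-scaleˡ ⟦ allowed (suc M) ⟧ (q^ suc M) (partitionSeries (suc M)) k))
    where
    open ≈-Reasoning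
    F = optionalFactor (allowed (suc M)) M
    F⊗next≈current : F ⊗ partitionSeries (suc M) ≈ partitionSeries M
    F⊗next≈current = begin
      F ⊗ (partitionSeries M ⊗ optionalFactor⁻¹ (allowed (suc M)) M)
        ≈⟨ x⊗yz≈y⊗xz F (partitionSeries M) _ ⟩
      partitionSeries M ⊗ (F ⊗ optionalFactor⁻¹ (allowed (suc M)) M)
        ≈⟨ ⊗-congˡ (partitionSeries M) (optionalFactor-inverse (allowed (suc M)) M) ⟩
      partitionSeries M ⊗ 𝟙
        ≈⟨ ⊗-identityʳ (partitionSeries M) ⟩
      partitionSeries M  ∎

  count-partsBounded : ∀ f M m → m ≤ f → count (partsBounded f M m) ≡ partitionSeries M m
  count-partsBounded f       M zero    _         = sym (partitionSeries-zero M)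
  count-partsBounded (suc f) M (suc n) (s≤s n≤f) = sum M
    where
    open ≡-Reasoning
    G : ℕ → List (List ℕ)
    G p = map (p ∷_) (partsBounded f p (suc n ∸ p))
    Q = λ p → p ≤? suc n
    last : ∀ M →
      count (concatMap G (filter Q [ suc M ])) ≡ ⟦ allowed (suc M) ⟧ *ₚ (q^ suc M ⊗ partitionSeries (suc M)) (suc n)
    last M with suc M ≤? suc n
    ... | yes M<n+1@(s≤s M≤n) = begin
      count (concatMap G (filter Q [ suc M ]))
        ≡⟨ cong (count ∘ concatMap G) (filter-accept Q M<n+1) ⟩
      count (G (suc M) ++ [])
        ≡⟨ cong count (++-identityʳ (G (suc M))) ⟩
      count (G (suc M))
        ≡⟨ count-map-∷ (suc M) (partsBounded f (suc M) (n ∸ M)) ⟩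
      a *ₚ count (partsBounded f (suc M) (n ∸ M))
        ≡⟨ cong (a *ₚ_) (count-partsBounded f (suc M) (n ∸ M) (≤-trans (m∸n≤m n M) n≤f)) ⟩
      a *ₚ partitionSeries (suc M) (n ∸ M)
        ≡⟨ cong (a *ₚ_) (sym (q^⊗-at (suc M) (partitionSeries (suc M)) (n ∸ M))) ⟩
      a *ₚ (q^ suc M ⊗ partitionSeries (suc M)) (suc M + (n ∸ M))
        ≡⟨ cong (λ k → a *ₚ (q^ suc M ⊗ partitionSeries (suc M)) (suc k)) (m+[n∸m]≡n M≤n) ⟩
      a *ₚ (q^ suc M ⊗ partitionSeries (suc M)) (suc n)  ∎
      where
      a = ⟦ allowed (suc M) ⟧
    ... | no M≮n = begin
      count (concatMap G (filter Q [ suc M ]))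
        ≡⟨ cong (count ∘ concatMap G) (filter-reject Q M≮n) ⟩
      0ℙ
        ≡⟨ sym (*ₚ-zeroʳ a) ⟩
      a *ₚ 0ℙ
        ≡⟨ cong (a *ₚ_) (sym (q^⊗-below (suc M) (partitionSeries (suc M)) (≰⇒> M≮n))) ⟩
      a *ₚ (q^ suc M ⊗ partitionSeries (suc M)) (suc n)  ∎
      where
      a = ⟦ allowed (suc M) ⟧
    sum : ∀ M → count (concatMap G (filter Q (applyUpTo suc M))) ≡ partitionSeries M (suc n)
    sum zero    = refl
    sum (suc M) = begin
      count (concatMap G (filter Q (applyUpTo suc (suc M))))
        ≡⟨ cong (λ xs → count (concatMap G (filter Q xs))) (sym (applyUpTo-∷ʳ suc M)) ⟩
      count (concatMap G (filter Q (applyUpTo suc M ++ [ suc M ])))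
        ≡⟨ cong (λ xs → count (concatMap G xs)) (filter-++ Q (applyUpTo suc M) [ suc M ]) ⟩
      count (concatMap G (filter Q (applyUpTo suc M) ++ filter Q [ suc M ]))
        ≡⟨ cong count (concatMap-++ G (filter Q (applyUpTo suc M)) (filter Q [ suc M ])) ⟩
      count (concatMap G (filter Q (applyUpTo suc M)) ++ concatMap G (filter Q [ suc M ]))
        ≡⟨ count-++ (concatMap G (filter Q (applyUpTo suc M))) (concatMap G (filter Q [ suc M ])) ⟩
      count (concatMap G (filter Q (applyUpTo suc M))) +ₚ count (concatMap G (filter Q [ suc M ]))
        ≡⟨ cong₂ _+ₚ_ (sum M) (last M) ⟩
      partitionSeries M (suc n) +ₚ ⟦ allowed (suc M) ⟧ *ₚ (q^ suc M ⊗ partitionSeries (suc M)) (suc n)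
        ≡⟨ sym (partitionSeries-suc M (suc n)) ⟩
      partitionSeries (suc M) (suc n)  ∎

  partitionSeries-stable : ∀ M d → partitionSeries (M + d) ≈[ suc M ] partitionSeries M
  partitionSeries-stable M d = ∏-extend[] M d _ (λ i _ →
    ≈[]-weaken (s≤s (m≤m+n M i)) (optionalFactor⁻¹-≈[]-𝟙 (allowed (suc (M + i))) (M + i)))

  partitionSeries⁻¹-stable : ∀ M d → partitionSeries⁻¹ (M + d) ≈[ suc M ] partitionSeries⁻¹ M
  partitionSeries⁻¹-stable M d = ∏-extend[] M d _ (λ i _ →
    optionalFactor-≈[]-𝟙 (allowed (suc (M + i))) (M + i) (s≤s (m≤m+n M i)))

open PartitionParity (λ p → ¬? (p % 4 ≟ 2))

allowed-mod-4 : ∀ j r → allowed (suc (j * 4 + r)) ≡ allowed (suc r)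
allowed-mod-4 j r = cong (λ k → does (¬? (k ≟ 2))) (trans (cong (_% 4) (shift j r)) ([m+kn]%n≡m%n (suc r) j 4))
  where
  shift : ∀ j r → suc (j * 4 + r) ≡ suc r + j * 4
  shift = solve-∀

partitionSeries⁻¹-block : ∀ j → ∏ 4 (λ r → optionalFactor (allowed (suc (j * 4 + r))) (j * 4 + r)) ≈
              1+q^ (3 + 4 * j) ⊗ 1+q^ (1 + 4 * j) ⊗ 1+q^ (4 + 4 * j)
partitionSeries⁻¹-block j = begin
  𝟙 ⊗ f 0 ⊗ f 1 ⊗ f 2 ⊗ f 3
    ≈⟨ ⊗-cong (⊗-cong (⊗-cong (⊗-congˡ 𝟙 (residue 0)) (residue 1)) (residue 2)) (residue 3) ⟩
  𝟙 ⊗ 1+q^ (1 + 4 * j) ⊗ (𝟙 ⊕ 𝟘) ⊗ 1+q^ (3 + 4 * j) ⊗ 1+q^ (4 + 4 * j)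
    ≈⟨ regroup (1+q^ (1 + 4 * j)) (1+q^ (3 + 4 * j)) (1+q^ (4 + 4 * j)) ⟩
  1+q^ (3 + 4 * j) ⊗ 1+q^ (1 + 4 * j) ⊗ 1+q^ (4 + 4 * j)  ∎
  where
  open ≈-Reasoning
  f : ℕ → Series
  f r = optionalFactor (allowed (suc (j * 4 + r))) (j * 4 + r)
  residue : ∀ r → f r ≈ optionalFactor (allowed (suc r)) (r + 4 * j)
  residue r = ≡⇒≈ (cong₂ optionalFactor (allowed-mod-4 j r) (trans (+-comm (j * 4) r) (cong (r +_) (*-comm j 4))))
  regroup : ∀ a c d → 𝟙 ⊗ a ⊗ (𝟙 ⊕ 𝟘) ⊗ c ⊗ d ≈ c ⊗ a ⊗ d
  regroup = solve 3 (λ a c d → con 1ℙ :* a :* (con 1ℙ :+ con 0ℙ) :* c :* d := c :* a :* d) (λ _ → refl)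

partitionSeries⁻¹-blocks : ∀ K → partitionSeries⁻¹ (K * 4) ≈ ∏₄ 3 K ⊗ ∏₄ 1 K ⊗ ∏₄ 4 K
partitionSeries⁻¹-blocks K = begin
  partitionSeries⁻¹ (K * 4)
    ≈⟨ ∏-blocks 4 K _ ⟩
  ∏ K (λ j → ∏ 4 (λ r → optionalFactor (allowed (suc (j * 4 + r))) (j * 4 + r)))
    ≈⟨ ∏-cong K (λ j _ → partitionSeries⁻¹-block j) ⟩
  ∏ K (λ j → 1+q^ (3 + 4 * j) ⊗ 1+q^ (1 + 4 * j) ⊗ 1+q^ (4 + 4 * j))
    ≈⟨ ∏-⊗ K (λ j → 1+q^ (3 + 4 * j) ⊗ 1+q^ (1 + 4 * j)) (λ j → 1+q^ (4 + 4 * j)) ⟩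
  ∏ K (λ j → 1+q^ (3 + 4 * j) ⊗ 1+q^ (1 + 4 * j)) ⊗ ∏₄ 4 K
    ≈⟨ ⊗-congʳ (∏₄ 4 K) (∏-⊗ K (λ j → 1+q^ (3 + 4 * j)) (λ j → 1+q^ (1 + 4 * j))) ⟩
  ∏₄ 3 K ⊗ ∏₄ 1 K ⊗ ∏₄ 4 K  ∎
  where open ≈-Reasoning

ψ≈[]partitionSeries⁻¹ : ∀ n → ψ (suc n) ≈[ suc n ] partitionSeries⁻¹ n
ψ≈[]partitionSeries⁻¹ n = begin
  ψ (suc n)
    ≈⟨ ψ≈[]∏ n ⟩
  ∏₄ 3 N ⊗ ∏₄ 1 N ⊗ ∏₄ 4 (N + N)
    ≈⟨ ⊗-cong[] (⊗-cong[] (≈[]-sym (∏₄-extend[] 3 N N (bound 3 (s≤s z≤n))))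
                          (≈[]-sym (∏₄-extend[] 1 N N (bound 1 (s≤s z≤n)))))
                (λ _ _ → refl) ⟩
  ∏₄ 3 (N + N) ⊗ ∏₄ 1 (N + N) ⊗ ∏₄ 4 (N + N)
    ≈⟨ ≈⇒≈[] (≈-sym (partitionSeries⁻¹-blocks (N + N))) ⟩
  partitionSeries⁻¹ ((N + N) * 4)
    ≈⟨ ≈⇒≈[] (≡⇒≈ (cong partitionSeries⁻¹ (sym n+d≡4K))) ⟩
  partitionSeries⁻¹ (n + ((N + N) * 4 ∸ n))
    ≈⟨ partitionSeries⁻¹-stable n ((N + N) * 4 ∸ n) ⟩
  partitionSeries⁻¹ n  ∎
  where
  open ≈[]-Reasoning (suc n)
  N = n + n
  bound : ∀ r → 0 < r → suc n ≤ r + 4 * N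
  bound r 0<r = +-mono-≤ 0<r (≤-trans (m≤m+n n n) (m≤n*m N 4))
  n+d≡4K : n + ((N + N) * 4 ∸ n) ≡ (N + N) * 4
  n+d≡4K = m+[n∸m]≡n (≤-trans (m≤m+n n n) (≤-trans (m≤m+n N N) (m≤m*n (N + N) 4)))

tri≡triangle : ∀ k → tri k ≡ triangle k
tri≡triangle k = begin
  k * suc k / 2       ≡⟨ cong (_/ 2) (sym (triangle-double k)) ⟩
  2 * triangle k / 2  ≡⟨ cong (_/ 2) (*-comm 2 (triangle k)) ⟩
  triangle k * 2 / 2  ≡⟨ m*n/n≡m (triangle k) 2 ⟩
  triangle k          ∎
  where open ≡-Reasoning

parity-term : ∀ n k → parity (term n k) ≡ (q^ triangle k ⊗ partitionSeries n) n
parity-term n k with tri k ≤? n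
... | yes t≤n = begin
  parity (P₂ (n ∸ t))
    ≡⟨ count-partsBounded (n ∸ t) (n ∸ t) (n ∸ t) ≤-refl ⟩
  partitionSeries (n ∸ t) (n ∸ t)
    ≡⟨ sym (partitionSeries-stable (n ∸ t) t (n ∸ t) ≤-refl) ⟩
  partitionSeries (n ∸ t + t) (n ∸ t)
    ≡⟨ cong (λ M → partitionSeries M (n ∸ t)) (m∸n+n≡m t≤n) ⟩
  partitionSeries n (n ∸ t)
    ≡⟨ cong (λ t → partitionSeries n (n ∸ t)) (tri≡triangle k) ⟩
  partitionSeries n (n ∸ T)
    ≡⟨ sym (q^⊗-at T (partitionSeries n) (n ∸ T)) ⟩
  (q^ T ⊗ partitionSeries n) (T + (n ∸ T))
    ≡⟨ cong (q^ T ⊗ partitionSeries n) (m+[n∸m]≡n (subst (_≤ n) (tri≡triangle k) t≤n)) ⟩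
  (q^ T ⊗ partitionSeries n) n  ∎
  where
  open ≡-Reasoning
  t = tri k
  T = triangle k
... | no t≰n = sym (q^⊗-below (triangle k) (partitionSeries n) (subst (n <_) (tri≡triangle k) (≰⇒> t≰n)))

parity-sumTo : ∀ n N → parity (sumTo N (term n)) ≡ (ψ (suc N) ⊗ partitionSeries n) n
parity-sumTo n zero    = parity-term n 0
parity-sumTo n (suc N) = begin
  parity (sumTo N (term n) + term n (suc N))
    ≡⟨ +-homo-+ (sumTo N (term n)) (term n (suc N)) ⟩
  parity (sumTo N (term n)) +ₚ parity (term n (suc N))
    ≡⟨ cong₂ _+ₚ_ (parity-sumTo n N) (parity-term n (suc N)) ⟩
  (ψ (suc N) ⊗ partitionSeries n) n +ₚ (q^ triangle (suc N) ⊗ partitionSeries n) n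
    ≡⟨ sym (⊗-distribʳ-⊕ (ψ (suc N)) (q^ triangle (suc N)) (partitionSeries n) n) ⟩
  (ψ (suc (suc N)) ⊗ partitionSeries n) n  ∎
  where open ≡-Reasoning

parity≡0ℙ⇒2∣ : ∀ m → parity m ≡ 0ℙ → 2 ∣ m
parity≡0ℙ⇒2∣ zero          _  = divides 0 refl
parity≡0ℙ⇒2∣ (suc zero)    ()
parity≡0ℙ⇒2∣ (suc (suc m)) eq with parity≡0ℙ⇒2∣ m eq
... | divides k m≡k*2 = divides (suc k) (cong (λ x → suc (suc x)) m≡k*2)

corollary3p9 : (n : ℕ) → 0 < n → 2 ∣ triSum n
corollary3p9 n@(suc _) _ = parity≡0ℙ⇒2∣ (triSum n) (begin
  parity (triSum n)                            ≡⟨ parity-sumTo n n ⟩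
  (ψ (suc n) ⊗ partitionSeries n) n            ≡⟨ ⊗-cong[] (ψ≈[]partitionSeries⁻¹ n) (λ _ _ → refl) n ≤-refl ⟩
  (partitionSeries⁻¹ n ⊗ partitionSeries n) n  ≡⟨ partitionSeries-inverse n n ⟩
  0ℙ                                           ∎)
  where open ≡-Reasoning
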